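{- Let $\widehat P_4$ denote the $5$-vertex graph obtained from the path $P_4$ on four vertices by adding one new vertex adjacent to all four vertices of the path. Suppose $(n,t)\in\{(9,11),(10,13),(11,16)\}$ and $G$ is a simple graph on $n$ vertices in which every edge is contained in at least one triangle, and $G$ contains exactly $t$ triangles. Then $G$ contains $\widehat P_4$ as a (not necessarily induced) subgraph.
   Context: All graphs are finite and simple. A triangle of $G$ is a set of three pairwise adjacent vertices. The paper calls a graph "edge-minimal" when every edge lies in a triangle, and this is the hypothesis stated in the claim. -}

module Defs where

open import Data.Nat using (ℕ)
open import Data.Fin using (Fin; _<_; _<?_)
open import Data.Fin.Patterns using (0F; 1F; 2F; 3F; 4F)
open import Data.List using (List; length; filter; allFin; cartesianProduct)
open import Data.Product using (Σ; _×_; _,_; ∃)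
open import Function.Definitions using (Injective)
open import Relation.Binary.PropositionalEquality using (_≡_)
open import Relation.Nullary using (¬_; Dec)
open import Relation.Nullary.Decidable using (_×-dec_)
open import Relation.Binary using (Decidable)

record Graph (n : ℕ) : Set₁ where
  field
    Adj   : Fin n → Fin n → Set
    adj?  : Decidable Adj
    sym   : ∀ {u v} → Adj u v → Adj v u
    irrefl : ∀ {u} → ¬ Adj u u
open Graph public

IsTriangle : ∀ {n} → Graph n → Fin n → Fin n → Fin n → Set
IsTriangle G u v w = Adj G u v × Adj G v w × Adj G u w

EveryEdgeInTriangle : ∀ {n} → Graph n → Set
EveryEdgeInTriangle {n} G = ∀ u v → Adj G u v → ∃ λ w → Adj G u w × Adj G v w

-- triangles counted as triples u < v < w (each 3-set exactly once)
triples : (n : ℕ) → List (Fin n × Fin n × Fin n)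
triples n = cartesianProduct (allFin n) (cartesianProduct (allFin n) (allFin n))

IsOrderedTriangle : ∀ {n} → Graph n → Fin n × Fin n × Fin n → Set
IsOrderedTriangle G (u , v , w) = (u < v × v < w) × IsTriangle G u v w

isOrderedTriangle? : ∀ {n} (G : Graph n) (t : Fin n × Fin n × Fin n) → Dec (IsOrderedTriangle G t)
isOrderedTriangle? G (u , v , w) =
  ((u <? v) ×-dec (v <? w)) ×-dec (adj? G u v ×-dec (adj? G v w ×-dec adj? G u w))

triangleCount : ∀ {n} → Graph n → ℕ
triangleCount {n} G = length (filter (isOrderedTriangle? G) (triples n))

data P4HatEdge : Fin 5 → Fin 5 → Set where
  e01 : P4HatEdge 0F 1F
  e12 : P4HatEdge 1F 2F
  e23 : P4HatEdge 2F 3F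
  e40 : P4HatEdge 4F 0F
  e41 : P4HatEdge 4F 1F
  e42 : P4HatEdge 4F 2F
  e43 : P4HatEdge 4F 3F

ContainsP4Hat : ∀ {n} → Graph n → Set
ContainsP4Hat {n} G = Σ (Fin 5 → Fin n) λ f →
  Injective _≡_ _≡_ f × (∀ {a b} → P4HatEdge a b → Adj G (f a) (f b))

-- In a gem-free graph a vertex set with k ≤ 11 vertices spans at most maxTriangles k triangles (10, 12 and 15 for
-- k = 9, 10, 11), by strong induction on k.
-- Without a K4, two edges of a triangle that both lie in further triangles would create a K4 or a gem; so one can
-- select two edges of every triangle lying in no other triangle. The selected edges form a triangle-free graph with
-- 2t edges, and Mantel's theorem gives t ≤ k²/8.
-- With a K4, a vertex outside it has at most one neighbour in it (otherwise there is a gem). Removing the K4 vertices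
-- one at a time therefore only destroys the four triangles of the K4 and, at each K4 vertex v, the triangles formed
-- with edges among the outside neighbours of v; bounding these by the outside degrees and applying the induction
-- hypothesis at a suitable depth leaves a finite case analysis.

module Submission where

open import Defs hiding (sym)
open import Data.Nat hiding (_<?_)
open import Data.Nat.Properties hiding (_<?_)
open import Data.Nat.Induction using (<-rec)
open import Data.Nat.Tactic.RingSolver using (solve-∀)
open import Data.Fin using (Fin; zero; suc) renaming (_<_ to _<F_; _<?_ to _<?F_)
open import Data.Fin.Patterns using (0F; 1F; 2F; 3F; 4F)
open import Data.Fin.Properties using (any?)
  renaming (_≟_ to _≟F_; <-cmp to <F-cmp; <-asym to <F-asym; <-trans to <F-trans)
open import Data.Bool using (Bool; true; false; if_then_else_)
open import Data.Bool.Properties using () renaming (_≟_ to _≟B_)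
open import Data.List using (List; []; _∷_; length; filter; map; _++_; tabulate; cartesianProduct; allFin)
open import Data.List.Properties using (filter-++; length-++)
open import Data.List.Relation.Unary.All using (All; []; _∷_)
open import Data.Product using (_×_; _,_; proj₁; proj₂; ∃; Σ-syntax)
open import Data.Sum using (_⊎_; inj₁; inj₂)
open import Data.Empty using (⊥; ⊥-elim)
open import Function using (_∘_; _⟨_⟩_)
open import Relation.Nullary using (Dec; yes; no; does; ¬_)
open import Relation.Nullary.Decidable using (_×-dec_; ¬?; map′)
open import Relation.Unary using (Pred) renaming (Decidable to DecP)
open import Relation.Binary using (tri<; tri≈; tri>)
open import Relation.Binary.PropositionalEquality
open import Algebra.Properties.Semiring.Sum +-*-semiring
  using (∑-distrib-+; ∑-comm; *-distribˡ-sum; *-distribʳ-sum; sum-replicate-zero)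
  renaming (sum to ∑; sum-cong-≗ to ∑-cong)

χ : ∀ {a} {A : Set a} → Dec A → ℕ
χ d = if does d then 1 else 0

χ≤1 : ∀ {a} {A : Set a} (d : Dec A) → χ d ≤ 1
χ≤1 (yes _) = s≤s z≤n
χ≤1 (no _) = z≤n

χ-yes : ∀ {a} {A : Set a} (d : Dec A) → A → χ d ≡ 1
χ-yes (yes _) _ = refl
χ-yes (no ¬a) a = ⊥-elim (¬a a)

χ-no : ∀ {a} {A : Set a} (d : Dec A) → ¬ A → χ d ≡ 0
χ-no (yes a) ¬a = ⊥-elim (¬a a)
χ-no (no _) _ = refl

χ>0 : ∀ {a} {A : Set a} (d : Dec A) → 0 < χ d → A
χ>0 (yes a) _ = a

χ-× : ∀ {a b} {A : Set a} {B : Set b} (p : Dec A) (q : Dec B) → χ (p ×-dec q) ≡ χ p * χ q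
χ-× (yes _) (yes _) = refl
χ-× (yes _) (no _) = refl
χ-× (no _) (yes _) = refl
χ-× (no _) (no _) = refl

χ-iff : ∀ {a b} {A : Set a} {B : Set b} (p : Dec A) (q : Dec B) → (A → B) → (B → A) → χ p ≡ χ q
χ-iff (yes _) (yes _) _ _ = refl
χ-iff (no _) (no _) _ _ = refl
χ-iff (yes a) (no ¬b) f _ = ⊥-elim (¬b (f a))
χ-iff (no ¬a) (yes b) _ g = ⊥-elim (¬a (g b))

δ : ∀ {n} → Fin n → Fin n → ℕ
δ v i = χ (i ≟F v)

δ-self : ∀ {n} (v : Fin n) → δ v v ≡ 1
δ-self v = χ-yes (v ≟F v) refl

≢⇒δ≡0 : ∀ {n} {v x : Fin n} → x ≢ v → δ v x ≡ 0
≢⇒δ≡0 {v = v} {x} = χ-no (x ≟F v)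

δ≡0⇒≢ : ∀ {n} {u y : Fin n} → δ u y ≡ 0 → y ≢ u
δ≡0⇒≢ {u = u} e refl with () ← trans (sym (δ-self u)) e

m*n>0⇒m>0 : ∀ m n → 0 < m * n → 0 < m
m*n>0⇒m>0 (suc m) n _ = s≤s z≤n

m*n>0⇒n>0 : ∀ m n → 0 < m * n → 0 < n
m*n>0⇒n>0 m n = m*n>0⇒m>0 n m ∘ subst (0 <_) (*-comm m n)

m>0⇒n≡0⇒m*n≡0 : ∀ m n → (0 < m → n ≡ 0) → m * n ≡ 0
m>0⇒n≡0⇒m*n≡0 zero n f = refl
m>0⇒n≡0⇒m*n≡0 (suc m) n f rewrite f (s≤s z≤n) = *-zeroʳ (suc m)

*-≤1 : ∀ {m n} → m ≤ 1 → n ≤ 1 → m * n ≤ 1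
*-≤1 {zero} _ _ = z≤n
*-≤1 {suc zero} {n} _ n≤1 = subst (_≤ 1) (sym (+-identityʳ n)) n≤1
*-≤1 {suc (suc _)} (s≤s ()) _

m≤1⇒m*m≡m : ∀ m → m ≤ 1 → m * m ≡ m
m≤1⇒m*m≡m zero _ = refl
m≤1⇒m*m≡m (suc zero) _ = refl
m≤1⇒m*m≡m (suc (suc _)) (s≤s ())

≥1∧≢1⇒≥2 : ∀ {m} → 1 ≤ m → m ≢ 1 → 2 ≤ m
≥1∧≢1⇒≥2 {suc zero} _ m≢1 = ⊥-elim (m≢1 refl)
≥1∧≢1⇒≥2 {suc (suc m)} _ _ = s≤s (s≤s z≤n)

∑-mono : ∀ {n} {f g : Fin n → ℕ} → (∀ i → f i ≤ g i) → ∑ f ≤ ∑ g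
∑-mono {zero} e = z≤n
∑-mono {suc n} e = +-mono-≤ (e zero) (∑-mono (e ∘ suc))

∑-*ˡ : ∀ {n} (c : ℕ) (f : Fin n → ℕ) → ∑ (λ i → c * f i) ≡ c * ∑ f
∑-*ˡ c f = sym (*-distribˡ-sum c f)

∑-*ʳ : ∀ {n} (c : ℕ) (f : Fin n → ℕ) → ∑ (λ i → f i * c) ≡ ∑ f * c
∑-*ʳ c f = sym (*-distribʳ-sum c f)

∑-const : ∀ {n} c → ∑ {n} (λ _ → c) ≡ n * c
∑-const {zero} c = refl
∑-const {suc n} c = cong (c +_) (∑-const {n} c)

∑-δ : ∀ {n} (v : Fin n) (f : Fin n → ℕ) → ∑ (λ i → δ v i * f i) ≡ f v
∑-δ {suc n} zero f = trans (cong (f zero + 0 +_) (sum-replicate-zero n)) (trans (+-identityʳ _) (+-identityʳ _))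
∑-δ {suc n} (suc v) f = ∑-δ v (f ∘ suc)

∑-δ-1 : ∀ {n} (v : Fin n) → ∑ (δ v) ≡ 1
∑-δ-1 v = trans (∑-cong λ x → sym (*-identityʳ (δ v x))) (∑-δ v (λ _ → 1))

term≤∑ : ∀ {n} (f : Fin n → ℕ) i → f i ≤ ∑ f
term≤∑ f zero = m≤m+n (f zero) _
term≤∑ f (suc i) = ≤-trans (term≤∑ (f ∘ suc) i) (m≤n+m _ (f zero))

∑>0⇒∃>0 : ∀ {n} (f : Fin n → ℕ) → 0 < ∑ f → ∃ λ i → 0 < f i
∑>0⇒∃>0 {suc n} f p with f zero in eq
... | suc k = zero , subst (0 <_) (sym eq) (s≤s z≤n)
... | zero with ∑>0⇒∃>0 (f ∘ suc) p
... | i , q = suc i , q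

2≤∑-of-two-positive : ∀ {n} (f : Fin n → ℕ) i j → i ≢ j → 0 < f i → 0 < f j → 2 ≤ ∑ f
2≤∑-of-two-positive f i j i≢j fi>0 fj>0 = begin
  2                        ≡⟨ sym (trans (∑-distrib-+ (δ i) (δ j)) (cong₂ _+_ (∑-δ-1 i) (∑-δ-1 j))) ⟩
  ∑ (λ x → δ i x + δ j x)  ≤⟨ ∑-mono bound ⟩
  ∑ f                      ∎
  where
  open ≤-Reasoning
  bound : ∀ x → δ i x + δ j x ≤ f x
  bound x with x ≟F i | x ≟F j
  ... | yes refl | yes refl = ⊥-elim (i≢j refl)
  ... | yes refl | no _ = fi>0
  ... | no _ | yes refl = fj>0
  ... | no _ | no _ = z≤n

2≤∑⇒∃-other-positive : ∀ {n} (f : Fin n → ℕ) i → 2 ≤ ∑ f → f i ≤ 1 → ∃ λ j → j ≢ i × 0 < f j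
2≤∑⇒∃-other-positive f i 2≤∑f fi≤1 =
  let j , p = ∑>0⇒∃>0 (λ j → ν j * f j) rest>0 in
  j , ν>0⇒≢ j (m*n>0⇒m>0 (ν j) (f j) p) , m*n>0⇒n>0 (ν j) (f j) p
  where
  ν : _ → ℕ
  ν j = if does (j ≟F i) then 0 else 1
  ν>0⇒≢ : ∀ j → 0 < ν j → j ≢ i
  ν>0⇒≢ j _ with j ≟F i
  ... | no j≢i = j≢i
  δ+ν≡1 : ∀ j → δ i j + ν j ≡ 1
  δ+ν≡1 j with j ≟F i
  ... | yes _ = refl
  ... | no _ = refl
  split : ∑ f ≡ f i + ∑ (λ j → ν j * f j)
  split = trans (∑-cong λ j → trans (sym (*-identityˡ (f j))) (trans (cong (_* f j) (sym (δ+ν≡1 j))) (*-distribʳ-+ (f j) (δ i j) (ν j))))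
    (trans (∑-distrib-+ (λ j → δ i j * f j) (λ j → ν j * f j)) (cong (_+ ∑ (λ j → ν j * f j)) (∑-δ i f)))
  rest>0 : 0 < ∑ (λ j → ν j * f j)
  rest>0 = +-cancelˡ-< 1 0 _ (≤-trans 2≤∑f (subst (_≤ 1 + ∑ (λ j → ν j * f j)) (sym split) (+-monoˡ-≤ _ fi≤1)))

amgm-≤ : ∀ a b → a ≤ b → 2 * a * b ≤ a * a + b * b
amgm-≤ a b a≤b with b ∸ a | m+[n∸m]≡n a≤b
... | k | refl = subst (2 * a * (a + k) ≤_) (sym (identity a k)) (m≤m+n (2 * a * (a + k)) (k * k))
  where
  identity : ∀ a k → a * a + (a + k) * (a + k) ≡ 2 * a * (a + k) + k * k
  identity = solve-∀

amgm : ∀ a b → 2 * a * b ≤ a * a + b * b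
amgm a b with ≤-total a b
... | inj₁ a≤b = amgm-≤ a b a≤b
... | inj₂ b≤a = subst₂ _≤_ (swap a b) (+-comm (b * b) (a * a)) (amgm-≤ b a b≤a)
  where
  swap : ∀ a b → 2 * b * a ≡ 2 * a * b
  swap = solve-∀

m*m≤0⇒m≡0 : ∀ m → m * m ≤ 0 → m ≡ 0
m*m≤0⇒m≡0 zero _ = refl

cauchySchwarz-cross : ∀ a S W Q → S * S ≤ W * Q → 2 * a * S ≤ Q + W * a * a
cauchySchwarz-cross a S zero Q h rewrite m*m≤0⇒m≡0 S h | *-zeroʳ (2 * a) = z≤n
cauchySchwarz-cross a S W@(suc _) Q h = *-cancelˡ-≤ W (begin
  W * (2 * a * S)           ≡⟨ e1 W a S ⟩
  2 * (W * a) * S           ≤⟨ amgm (W * a) S ⟩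
  W * a * (W * a) + S * S   ≤⟨ +-monoʳ-≤ _ h ⟩
  W * a * (W * a) + W * Q   ≡⟨ e2 W a Q ⟩
  W * (Q + W * a * a)       ∎)
  where
  open ≤-Reasoning
  e1 : ∀ w a s → w * (2 * a * s) ≡ 2 * (w * a) * s
  e1 = solve-∀
  e2 : ∀ w a q → w * a * (w * a) + w * q ≡ w * (q + w * a * a)
  e2 = solve-∀

cauchySchwarz-step : ∀ a S W Q → S * S ≤ W * Q → (a + S) * (a + S) ≤ (1 + W) * (a * a + Q)
cauchySchwarz-step a S W Q h = begin
  (a + S) * (a + S)                 ≡⟨ e1 a S ⟩
  a * a + 2 * a * S + S * S         ≤⟨ +-mono-≤ (+-monoʳ-≤ (a * a) (cauchySchwarz-cross a S W Q h)) h ⟩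
  a * a + (Q + W * a * a) + W * Q   ≡⟨ e2 a W Q ⟩
  (1 + W) * (a * a + Q)             ∎
  where
  open ≤-Reasoning
  e1 : ∀ a s → (a + s) * (a + s) ≡ a * a + 2 * a * s + s * s
  e1 = solve-∀
  e2 : ∀ a w q → a * a + (q + w * a * a) + w * q ≡ (1 + w) * (a * a + q)
  e2 = solve-∀

cauchySchwarz : ∀ {n} (w d : Fin n → ℕ) → (∀ x → w x ≤ 1) → (∀ x → w x ≡ 0 → d x ≡ 0) →
                ∑ d * ∑ d ≤ ∑ w * ∑ (λ x → d x * d x)
cauchySchwarz {zero} w d w≤1 w≡0⇒d≡0 = z≤n
cauchySchwarz {suc n} w d w≤1 w≡0⇒d≡0 with w zero | n≤1⇒n≡0∨n≡1 (w≤1 zero) | w≡0⇒d≡0 zero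
... | _ | inj₁ refl | d₀≡0 rewrite d₀≡0 refl = cauchySchwarz (w ∘ suc) (d ∘ suc) (w≤1 ∘ suc) (w≡0⇒d≡0 ∘ suc)
... | _ | inj₂ refl | _ = cauchySchwarz-step (d zero) (∑ (d ∘ suc)) (∑ (w ∘ suc)) (∑ (λ x → d (suc x) * d (suc x)))
                           (cauchySchwarz (w ∘ suc) (d ∘ suc) (w≤1 ∘ suc) (w≡0⇒d≡0 ∘ suc))

-- Mantel's theorem: R is the 0/1 adjacency of a triangle-free graph on the vertex set with indicator w.
-- Triangle-freeness gives d x + d y ≤ ∑ w on every edge; summing over edges, ∑ d² ≤ ∑ w · |E|.
module _ {n : ℕ} (w : Fin n → ℕ) (R : Fin n → Fin n → ℕ)
  (w≤1 : ∀ x → w x ≤ 1) (R≤1 : ∀ x y → R x y ≤ 1) (R-sym : ∀ x y → R x y ≡ R y x)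
  (R≤w : ∀ x y → R x y ≤ w x) (triangle-free : ∀ x y z → R x y ≡ 1 → R x z + R y z ≤ w z) where

  private
    d : Fin n → ℕ
    d x = ∑ (R x)

    m 2E ∑d² : ℕ
    m = ∑ w
    2E = ∑ d
    ∑d² = ∑ (λ x → d x * d x)

    edge-degrees≤ : ∀ x y → R x y * (d x + d y) ≤ R x y * m
    edge-degrees≤ x y with R x y | n≤1⇒n≡0∨n≡1 (R≤1 x y) | triangle-free x y
    ... | _ | inj₁ refl | _ = z≤n
    ... | _ | inj₂ refl | disjoint =
      +-monoˡ-≤ 0 (subst (_≤ m) (∑-distrib-+ (R x) (R y)) (∑-mono λ z → disjoint z refl))

    ∑-edge-degrees≤ : ∑ (λ x → ∑ (λ y → R x y * (d x + d y))) ≤ m * 2E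
    ∑-edge-degrees≤ = ≤-trans (∑-mono λ x → ∑-mono λ y → edge-degrees≤ x y)
      (≤-reflexive (trans (∑-cong λ x → ∑-*ʳ m (R x)) (trans (∑-*ʳ m d) (*-comm 2E m))))

    ∑-edge-degrees≡ : ∑ (λ x → ∑ (λ y → R x y * (d x + d y))) ≡ ∑d² + ∑d²
    ∑-edge-degrees≡ =
      trans (∑-cong λ x → trans (∑-cong λ y → *-distribˡ-+ (R x y) (d x) (d y)) (∑-distrib-+ (λ y → R x y * d x) (λ y → R x y * d y)))
      (trans (∑-distrib-+ (λ x → ∑ λ y → R x y * d x) (λ x → ∑ λ y → R x y * d y))
      (cong₂ _+_ (∑-cong λ x → ∑-*ʳ (d x) (R x))
        (trans (∑-comm (λ x y → R x y * d y)) (∑-cong λ y → trans (∑-*ʳ (d y) (λ x → R x y)) (cong (_* d y) (∑-cong λ x → R-sym x y))))))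

    w≡0⇒d≡0 : ∀ x → w x ≡ 0 → d x ≡ 0
    w≡0⇒d≡0 x e = n≤0⇒n≡0 (≤-trans (∑-mono {g = λ _ → 0} λ y → subst (R x y ≤_) e (R≤w x y)) (≤-reflexive (sum-replicate-zero n)))

    combine : ∀ p m q → p * p ≤ m * q → q + q ≤ m * p → 2 * p ≤ m * m
    combine zero m q _ _ = z≤n
    combine p@(suc _) m q h1 h2 = *-cancelˡ-≤ p (begin
      p * (2 * p)     ≡⟨ e0 p ⟩
      2 * (p * p)     ≤⟨ *-monoʳ-≤ 2 h1 ⟩
      2 * (m * q)     ≡⟨ e1 m q ⟩
      m * (q + q)     ≤⟨ *-monoʳ-≤ m h2 ⟩
      m * (m * p)     ≡⟨ e2 m p ⟩
      p * (m * m)     ∎)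
      where
      open ≤-Reasoning
      e0 : ∀ a → a * (2 * a) ≡ 2 * (a * a)
      e0 = solve-∀
      e1 : ∀ a b → 2 * (a * b) ≡ a * (b + b)
      e1 = solve-∀
      e2 : ∀ a b → a * (a * b) ≡ b * (a * a)
      e2 = solve-∀

  mantel : 2 * ∑ (λ x → ∑ (R x)) ≤ ∑ w * ∑ w
  mantel = combine 2E m ∑d² (cauchySchwarz w d w≤1 w≡0⇒d≡0) (subst (_≤ m * 2E) ∑-edge-degrees≡ ∑-edge-degrees≤)

-- The bound proved for gem-free graphs on k ≤ 11 vertices: at least ⌊k²/8⌋ (the K4-free case) and large enough
-- for the recursion through a K4. The value 0 beyond 11 is junk.
maxTriangles : ℕ → ℕ
maxTriangles 0 = 0
maxTriangles 1 = 0
maxTriangles 2 = 0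
maxTriangles 3 = 1
maxTriangles 4 = 4
maxTriangles 5 = 4
maxTriangles 6 = 5
maxTriangles 7 = 8
maxTriangles 8 = 8
maxTriangles 9 = 10
maxTriangles 10 = 12
maxTriangles 11 = 15
maxTriangles _ = 0

24*t≤c<24*[K+1]⇒t≤K : ∀ K c t → c < 24 * suc K → 24 * t ≤ c → t ≤ K
24*t≤c<24*[K+1]⇒t≤K K c t lt h with t ≤? K
... | yes p = p
... | no np = ⊥-elim (<-irrefl refl (<-≤-trans lt (≤-trans (*-monoʳ-≤ 24 (≰⇒> np)) h)))

K4Free-maxTriangles : ∀ k → k ≤ 11 → ∀ t → 24 * t ≤ 3 * (k * k) → t ≤ maxTriangles k
K4Free-maxTriangles 0 _ t h = 24*t≤c<24*[K+1]⇒t≤K 0 0 t (s≤s z≤n) h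
K4Free-maxTriangles 1 _ t h = 24*t≤c<24*[K+1]⇒t≤K 0 3 t (s≤s (s≤s (s≤s (s≤s z≤n)))) h
K4Free-maxTriangles 2 _ t h = 24*t≤c<24*[K+1]⇒t≤K 0 12 t (m≤m+n 13 11) h
K4Free-maxTriangles 3 _ t h = 24*t≤c<24*[K+1]⇒t≤K 1 27 t (m≤m+n 28 20) h
K4Free-maxTriangles 4 _ t h = 24*t≤c<24*[K+1]⇒t≤K 4 48 t (m≤m+n 49 71) h
K4Free-maxTriangles 5 _ t h = 24*t≤c<24*[K+1]⇒t≤K 4 75 t (m≤m+n 76 44) h
K4Free-maxTriangles 6 _ t h = 24*t≤c<24*[K+1]⇒t≤K 5 108 t (m≤m+n 109 35) h
K4Free-maxTriangles 7 _ t h = 24*t≤c<24*[K+1]⇒t≤K 8 147 t (m≤m+n 148 68) h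
K4Free-maxTriangles 8 _ t h = 24*t≤c<24*[K+1]⇒t≤K 8 192 t (m≤m+n 193 23) h
K4Free-maxTriangles 9 _ t h = 24*t≤c<24*[K+1]⇒t≤K 10 243 t (m≤m+n 244 20) h
K4Free-maxTriangles 10 _ t h = 24*t≤c<24*[K+1]⇒t≤K 12 300 t (m≤m+n 301 11) h
K4Free-maxTriangles 11 _ t h = 24*t≤c<24*[K+1]⇒t≤K 15 363 t (m≤m+n 364 20) h
K4Free-maxTriangles (suc (suc (suc (suc (suc (suc (suc (suc (suc (suc (suc (suc k)))))))))))) k≤11 t h =
  ⊥-elim (1+n≰n (≤-trans (m≤m+n 12 k) k≤11))

E+x≤x²∧E>0⇒x≥2 : ∀ {E x} → E + x ≤ x * x → 0 < E → 2 ≤ x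
E+x≤x²∧E>0⇒x≥2 {E} {zero} h p rewrite +-identityʳ E = ⊥-elim (<-irrefl refl (≤-trans p h))
E+x≤x²∧E>0⇒x≥2 {E} {suc zero} h p = ⊥-elim (<-irrefl refl (≤-trans (+-monoˡ-≤ 1 p) h))
E+x≤x²∧E>0⇒x≥2 {E} {suc (suc x)} h p = s≤s (s≤s z≤n)

E+x≤x²∧x≤2⇒E≤2 : ∀ {E x} → E + x ≤ x * x → x ≤ 2 → E ≤ 2
E+x≤x²∧x≤2⇒E≤2 {E} {zero} h _ rewrite +-identityʳ E = ≤-trans h z≤n
E+x≤x²∧x≤2⇒E≤2 {E} {suc zero} h _ = ≤-trans (+-cancelʳ-≤ 1 E 0 h) z≤n
E+x≤x²∧x≤2⇒E≤2 {E} {suc (suc zero)} h _ = +-cancelʳ-≤ 2 E 2 h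
E+x≤x²∧x≤2⇒E≤2 {E} {suc (suc (suc x))} h (s≤s (s≤s ()))

sum-of-squares≤square-of-sum : ∀ a b c d → a * a + b * b + c * c + d * d ≤ (a + b + c + d) * (a + b + c + d)
sum-of-squares≤square-of-sum a b c d =
  ≤-trans (m≤m+n (a * a + b * b + c * c + d * d) (2 * (a * b + a * c + a * d + b * c + b * d + c * d)))
          (≤-reflexive (e a b c d))
  where
  e : ∀ a b c d → a * a + b * b + c * c + d * d + 2 * (a * b + a * c + a * d + b * c + b * d + c * d) ≡ (a + b + c + d) * (a + b + c + d)
  e = solve-∀

E+s≤s²-mono : ∀ {E s k} → E + s ≤ s * s → s ≤ k → E + k ≤ k * k
E+s≤s²-mono {E} {s} {k} h s≤k with k ∸ s | m+[n∸m]≡n s≤k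
... | j | refl = begin
  E + (s + j)                  ≡˘⟨ +-assoc E s j ⟩
  E + s + j                    ≤⟨ +-mono-≤ h (j≤j*j j) ⟩
  s * s + j * j                ≤⟨ m≤m+n (s * s + j * j) (2 * s * j) ⟩
  s * s + j * j + 2 * s * j    ≡⟨ square s j ⟩
  (s + j) * (s + j)            ∎
  where
  open ≤-Reasoning
  square : ∀ s j → s * s + j * j + 2 * s * j ≡ (s + j) * (s + j)
  square = solve-∀
  j≤j*j : ∀ j → j ≤ j * j
  j≤j*j zero = z≤n
  j≤j*j j@(suc _) = m≤m*n j j

module _ {a p} {A : Set a} {P : Pred A p} (P? : DecP P) where
  length-filter-∷ : ∀ x xs → length (filter P? (x ∷ xs)) ≡ χ (P? x) + length (filter P? xs)
  length-filter-∷ x xs with does (P? x)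
  ... | true = refl
  ... | false = refl

  length-filter-++ : ∀ xs ys → length (filter P? (xs ++ ys)) ≡ length (filter P? xs) + length (filter P? ys)
  length-filter-++ xs ys = trans (cong length (filter-++ P? xs ys)) (length-++ (filter P? xs))

length-filter-map : ∀ {a b p} {A : Set a} {B : Set b} {P : Pred B p} (P? : DecP P) (f : A → B) (xs : List A) →
  length (filter P? (map f xs)) ≡ length (filter (P? ∘ f) xs)
length-filter-map P? f [] = refl
length-filter-map P? f (x ∷ xs) rewrite length-filter-∷ P? (f x) (map f xs) | length-filter-∷ (P? ∘ f) x xs | length-filter-map P? f xs = refl

length-filter-tabulate : ∀ {b p} {B : Set b} {P : Pred B p} (P? : DecP P) {n} (g : Fin n → B) →
  length (filter P? (tabulate g)) ≡ ∑ (λ i → χ (P? (g i)))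
length-filter-tabulate P? {zero} g = refl
length-filter-tabulate P? {suc n} g rewrite length-filter-∷ P? (g zero) (tabulate (g ∘ suc)) | length-filter-tabulate P? (g ∘ suc) = refl

length-filter-cartesianProduct : ∀ {b c p} {B : Set b} {C : Set c} {P : Pred (B × C) p} (P? : DecP P) {n} (g : Fin n → B) (ys : List C) →
  length (filter P? (cartesianProduct (tabulate g) ys)) ≡ ∑ (λ i → length (filter (λ y → P? (g i , y)) ys))
length-filter-cartesianProduct P? {zero} g ys = refl
length-filter-cartesianProduct P? {suc n} g ys = trans (length-filter-++ P? (map (g zero ,_) ys) (cartesianProduct (tabulate (g ∘ suc)) ys))
  (cong₂ _+_ (length-filter-map P? (g zero ,_) ys) (length-filter-cartesianProduct P? (g ∘ suc) ys))

length-filter-triples : ∀ {p} {n} {P : Pred (Fin n × Fin n × Fin n) p} (P? : DecP P) →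
  length (filter P? (cartesianProduct (allFin n) (cartesianProduct (allFin n) (allFin n))))
  ≡ ∑ (λ x → ∑ (λ y → ∑ (λ z → χ (P? (x , y , z)))))
length-filter-triples {n = n} P? = trans (length-filter-cartesianProduct P? {n} (λ i → i) _)
  (∑-cong λ x → trans (length-filter-cartesianProduct (λ y → P? (x , y)) {n} (λ i → i) _) (∑-cong λ y → length-filter-tabulate (λ z → P? (x , y , z)) {n} (λ i → i)))

at-most-one-of-four : ∀ {P Q R S : Set} (p : Dec P) (q : Dec Q) (r : Dec R) (s : Dec S) →
  (P → Q → ⊥) → (P → R → ⊥) → (P → S → ⊥) → (Q → R → ⊥) → (Q → S → ⊥) → (R → S → ⊥) →
  χ p + χ q + χ r + χ s ≤ 1
at-most-one-of-four (yes p) (yes q) _ _ f _ _ _ _ _ = ⊥-elim (f p q)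
at-most-one-of-four (yes p) (no _) (yes r) _ _ f _ _ _ _ = ⊥-elim (f p r)
at-most-one-of-four (yes p) (no _) (no _) (yes s) _ _ f _ _ _ = ⊥-elim (f p s)
at-most-one-of-four (yes p) (no _) (no _) (no _) _ _ _ _ _ _ = s≤s z≤n
at-most-one-of-four (no _) (yes q) (yes r) _ _ _ _ f _ _ = ⊥-elim (f q r)
at-most-one-of-four (no _) (yes q) (no _) (yes s) _ _ _ _ f _ = ⊥-elim (f q s)
at-most-one-of-four (no _) (yes q) (no _) (no _) _ _ _ _ _ _ = s≤s z≤n
at-most-one-of-four (no _) (no _) (yes r) (yes s) _ _ _ _ _ f = ⊥-elim (f r s)
at-most-one-of-four (no _) (no _) (yes r) (no _) _ _ _ _ _ _ = s≤s z≤n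
at-most-one-of-four (no _) (no _) (no _) (yes s) _ _ _ _ _ _ = s≤s z≤n
at-most-one-of-four (no _) (no _) (no _) (no _) _ _ _ _ _ _ = z≤n

-- No gem with centre c and path p q r s; the remaining distinctness conditions follow from adjacency.
NoGem : ∀ {n} → Graph n → Set
NoGem G = ∀ {c p q r s} → Adj G c p → Adj G c q → Adj G c r → Adj G c s → Adj G p q → Adj G q r → Adj G r s →
          p ≢ r → p ≢ s → q ≢ s → ⊥

module Triangles {n : ℕ} (G : Graph n) where

  A : Fin n → Fin n → ℕ
  A x y = χ (adj? G x y)

  A-sym : ∀ x y → A x y ≡ A y x
  A-sym x y with adj? G x y | adj? G y x
  ... | yes _ | yes _ = refl
  ... | no _ | no _ = refl
  ... | yes p | no q = ⊥-elim (q (Graph.sym G p))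
  ... | no q | yes p = ⊥-elim (q (Graph.sym G p))

  A-irrefl : ∀ x → A x x ≡ 0
  A-irrefl x with adj? G x x
  ... | yes p = ⊥-elim (Graph.irrefl G p)
  ... | no _ = refl

  Adj⇒A≡1 : ∀ {x y} → Adj G x y → A x y ≡ 1
  Adj⇒A≡1 {x} {y} p with adj? G x y
  ... | yes _ = refl
  ... | no q = ⊥-elim (q p)

  A>0⇒Adj : ∀ {x y} → 0 < A x y → Adj G x y
  A>0⇒Adj {x} {y} p with adj? G x y
  ... | yes q = q
  ... | no q with p
  ... | ()

  A≤1 : ∀ x y → A x y ≤ 1
  A≤1 x y = χ≤1 (adj? G x y)

  tri : Fin n → Fin n → Fin n → ℕ
  tri x y z = A x y * A y z * A x z

  tri-swap₁₂ : ∀ x y z → tri x y z ≡ tri y x z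
  tri-swap₁₂ x y z rewrite A-sym x y = rearrange (A y x) (A y z) (A x z)
    where
    rearrange : ∀ a b c → a * b * c ≡ a * c * b
    rearrange = solve-∀

  tri-swap₂₃ : ∀ x y z → tri x y z ≡ tri x z y
  tri-swap₂₃ x y z rewrite A-sym y z = rearrange (A x y) (A z y) (A x z)
    where
    rearrange : ∀ a b c → a * b * c ≡ c * b * a
    rearrange = solve-∀

  tri-xxz : ∀ x z → tri x x z ≡ 0
  tri-xxz x z rewrite A-irrefl x = refl

  tri-xyy : ∀ x y → tri x y y ≡ 0
  tri-xyy x y rewrite A-irrefl y | *-zeroʳ (A x y) = refl

  tri-xyx : ∀ x y → tri x y x ≡ 0
  tri-xyx x y rewrite A-irrefl x = *-zeroʳ (A x y * A y x)

  VertexSet : Set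
  VertexSet = Fin n → Bool

  member : VertexSet → Fin n → ℕ
  member s x = if s x then 1 else 0

  member≤1 : ∀ s x → member s x ≤ 1
  member≤1 s x with s x
  ... | true = s≤s z≤n
  ... | false = z≤n

  triIn : VertexSet → Fin n → Fin n → Fin n → ℕ
  triIn s x y z = member s x * member s y * member s z * tri x y z

  triIn-swap₁₂ : ∀ s x y z → triIn s x y z ≡ triIn s y x z
  triIn-swap₁₂ s x y z rewrite tri-swap₁₂ x y z = cong (_* tri y x z) (rearrange (member s x) (member s y) (member s z))
    where
    rearrange : ∀ a b c → a * b * c ≡ b * a * c
    rearrange = solve-∀

  triIn-swap₂₃ : ∀ s x y z → triIn s x y z ≡ triIn s x z y
  triIn-swap₂₃ s x y z rewrite tri-swap₂₃ x y z = cong (_* tri x z y) (rearrange (member s x) (member s y) (member s z))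
    where
    rearrange : ∀ a b c → a * b * c ≡ a * c * b
    rearrange = solve-∀

  ∑3 : (Fin n → Fin n → Fin n → ℕ) → ℕ
  ∑3 F = ∑ λ x → ∑ λ y → ∑ λ z → F x y z

  ∑3-cong : ∀ {F H : Fin n → Fin n → Fin n → ℕ} → (∀ x y z → F x y z ≡ H x y z) → ∑3 F ≡ ∑3 H
  ∑3-cong e = ∑-cong λ x → ∑-cong λ y → ∑-cong λ z → e x y z

  ∑3-+ : ∀ (F H : Fin n → Fin n → Fin n → ℕ) → ∑3 (λ x y z → F x y z + H x y z) ≡ ∑3 F + ∑3 H
  ∑3-+ F H = trans (∑-cong λ x → trans (∑-cong λ y → ∑-distrib-+ (F x y) (H x y)) (∑-distrib-+ (λ y → ∑ (F x y)) (λ y → ∑ (H x y))))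
    (∑-distrib-+ (λ x → ∑ λ y → ∑ (F x y)) (λ x → ∑ λ y → ∑ (H x y)))

  ∑3-swap₁₂ : ∀ (F : Fin n → Fin n → Fin n → ℕ) → ∑3 F ≡ ∑3 (λ x y z → F y x z)
  ∑3-swap₁₂ F = ∑-comm (λ x y → ∑ (F x y))

  ∑3-swap₂₃ : ∀ (F : Fin n → Fin n → Fin n → ℕ) → ∑3 F ≡ ∑3 (λ x y z → F x z y)
  ∑3-swap₂₃ F = ∑-cong λ x → ∑-comm (F x)

  ordTriangles : VertexSet → ℕ
  ordTriangles s = ∑3 (triIn s)

  lt : Fin n → Fin n → ℕ
  lt x y = χ (x <?F y)

  triangles : VertexSet → ℕ
  triangles s = ∑3 λ x y z → lt x y * lt y z * triIn s x y z

  <⇒lt≡1 : ∀ {x y} → x <F y → lt x y ≡ 1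
  <⇒lt≡1 {x} {y} p = χ-yes (x <?F y) p

  ≮⇒lt≡0 : ∀ {x y} → ¬ x <F y → lt x y ≡ 0
  ≮⇒lt≡0 {x} {y} p = χ-no (x <?F y) p

  orderings : Fin n → Fin n → Fin n → ℕ
  orderings x y z = lt x y * lt y z + lt x z * lt z y + lt y x * lt x z + lt y z * lt z x + lt z x * lt x y + lt z y * lt y x

  orderings-distinct : ∀ x y z → x ≢ y → y ≢ z → x ≢ z → orderings x y z ≡ 1
  orderings-distinct x y z xy yz xz with <F-cmp x y | <F-cmp y z | <F-cmp x z
  ... | tri≈ _ e _ | _ | _ = ⊥-elim (xy e)
  ... | _ | tri≈ _ e _ | _ = ⊥-elim (yz e)
  ... | _ | _ | tri≈ _ e _ = ⊥-elim (xz e)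
  ... | tri< a _ na | tri< b _ nb | tri< c _ nc
    rewrite <⇒lt≡1 a | ≮⇒lt≡0 na | <⇒lt≡1 b | ≮⇒lt≡0 nb | <⇒lt≡1 c | ≮⇒lt≡0 nc = refl
  ... | tri< a _ na | tri< b _ nb | tri> nc _ c = ⊥-elim (nc (<F-trans a b))
  ... | tri< a _ na | tri> nb _ b | tri< c _ nc
    rewrite <⇒lt≡1 a | ≮⇒lt≡0 na | <⇒lt≡1 b | ≮⇒lt≡0 nb | <⇒lt≡1 c | ≮⇒lt≡0 nc = refl
  ... | tri< a _ na | tri> nb _ b | tri> nc _ c
    rewrite <⇒lt≡1 a | ≮⇒lt≡0 na | <⇒lt≡1 b | ≮⇒lt≡0 nb | <⇒lt≡1 c | ≮⇒lt≡0 nc = refl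
  ... | tri> na _ a | tri< b _ nb | tri< c _ nc
    rewrite <⇒lt≡1 a | ≮⇒lt≡0 na | <⇒lt≡1 b | ≮⇒lt≡0 nb | <⇒lt≡1 c | ≮⇒lt≡0 nc = refl
  ... | tri> na _ a | tri< b _ nb | tri> nc _ c
    rewrite <⇒lt≡1 a | ≮⇒lt≡0 na | <⇒lt≡1 b | ≮⇒lt≡0 nb | <⇒lt≡1 c | ≮⇒lt≡0 nc = refl
  ... | tri> na _ a | tri> nb _ b | tri< c _ nc = ⊥-elim (nc (<F-trans b a))
  ... | tri> na _ a | tri> nb _ b | tri> nc _ c
    rewrite <⇒lt≡1 a | ≮⇒lt≡0 na | <⇒lt≡1 b | ≮⇒lt≡0 nb | <⇒lt≡1 c | ≮⇒lt≡0 nc = refl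

  triIn-xxz : ∀ s x z → triIn s x x z ≡ 0
  triIn-xxz s x z rewrite tri-xxz x z = *-zeroʳ (member s x * member s x * member s z)

  triIn-xyy : ∀ s x y → triIn s x y y ≡ 0
  triIn-xyy s x y rewrite tri-xyy x y = *-zeroʳ (member s x * member s y * member s y)

  triIn-xyx : ∀ s x y → triIn s x y x ≡ 0
  triIn-xyx s x y rewrite tri-xyx x y = *-zeroʳ (member s x * member s y * member s x)

  private
    a≡0⇒a≡b*a : ∀ {a} b → a ≡ 0 → a ≡ b * a
    a≡0⇒a≡b*a b refl = sym (*-zeroʳ b)

  triIn-orderings : ∀ s x y z → triIn s x y z ≡ orderings x y z * triIn s x y z
  triIn-orderings s x y z with x ≟F y | y ≟F z | x ≟F z
  ... | yes refl | _ | _ = a≡0⇒a≡b*a (orderings x x z) (triIn-xxz s x z)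
  ... | no _ | yes refl | _ = a≡0⇒a≡b*a (orderings x y y) (triIn-xyy s x y)
  ... | no _ | no _ | yes refl = a≡0⇒a≡b*a (orderings x y x) (triIn-xyx s x y)
  ... | no a | no b | no c rewrite orderings-distinct x y z a b c = sym (+-identityʳ _)

  ordTriangles≡6*triangles : ∀ s → ordTriangles s ≡ 6 * triangles s
  ordTriangles≡6*triangles s = begin
      ∑3 (triIn s)
    ≡⟨ ∑3-cong (triIn-orderings s) ⟩
      ∑3 (λ x y z → orderings x y z * triIn s x y z)
    ≡⟨ ∑3-cong (λ x y z → dist (lt x y) (lt y z) (lt x z) (lt z y) (lt y x) (lt z x) (triIn s x y z)) ⟩
      ∑3 (λ x y z → P1 x y z + P2 x y z + P3 x y z + P4 x y z + P5 x y z + P6 x y z)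
    ≡⟨ split ⟩
      ∑3 P1 + ∑3 P2 + ∑3 P3 + ∑3 P4 + ∑3 P5 + ∑3 P6
    ≡⟨ cong₂ _+_ (cong₂ _+_ (cong₂ _+_ (cong₂ _+_ (cong (triangles s +_) e2) e3) e4) e5) e6 ⟩
      triangles s + triangles s + triangles s + triangles s + triangles s + triangles s
    ≡⟨ six* (triangles s) ⟩
      6 * triangles s ∎
    where
    open ≡-Reasoning
    dist : ∀ a b c d e f t → (a * b + c * d + e * c + b * f + f * a + d * e) * t
      ≡ a * b * t + c * d * t + e * c * t + b * f * t + f * a * t + d * e * t
    dist = solve-∀
    six* : ∀ t → t + t + t + t + t + t ≡ 6 * t
    six* = solve-∀
    P1 P2 P3 P4 P5 P6 : Fin n → Fin n → Fin n → ℕ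
    P1 x y z = lt x y * lt y z * triIn s x y z
    P2 x y z = lt x z * lt z y * triIn s x y z
    P3 x y z = lt y x * lt x z * triIn s x y z
    P4 x y z = lt y z * lt z x * triIn s x y z
    P5 x y z = lt z x * lt x y * triIn s x y z
    P6 x y z = lt z y * lt y x * triIn s x y z
    split : ∑3 (λ x y z → P1 x y z + P2 x y z + P3 x y z + P4 x y z + P5 x y z + P6 x y z)
            ≡ ∑3 P1 + ∑3 P2 + ∑3 P3 + ∑3 P4 + ∑3 P5 + ∑3 P6
    split = trans (∑3-+ _ P6) (cong (_+ ∑3 P6) (trans (∑3-+ _ P5) (cong (_+ ∑3 P5)
            (trans (∑3-+ _ P4) (cong (_+ ∑3 P4) (trans (∑3-+ _ P3) (cong (_+ ∑3 P3) (∑3-+ P1 P2))))))))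
    e2 : ∑3 P2 ≡ triangles s
    e2 = trans (∑3-swap₂₃ P2) (∑3-cong λ x y z → cong (lt x y * lt y z *_) (triIn-swap₂₃ s x z y))
    e3 : ∑3 P3 ≡ triangles s
    e3 = trans (∑3-swap₁₂ P3) (∑3-cong λ x y z → cong (lt x y * lt y z *_) (triIn-swap₁₂ s y x z))
    e4 : ∑3 P4 ≡ triangles s
    e4 = trans (∑3-swap₁₂ P4) (trans (∑3-swap₂₃ _) (∑3-cong λ x y z →
           cong (lt x y * lt y z *_) (trans (triIn-swap₁₂ s z x y) (triIn-swap₂₃ s x z y))))
    e5 : ∑3 P5 ≡ triangles s
    e5 = trans (∑3-swap₂₃ P5) (trans (∑3-swap₁₂ _) (∑3-cong λ x y z →
           cong (lt x y * lt y z *_) (trans (triIn-swap₂₃ s y z x) (triIn-swap₁₂ s y x z))))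
    e6 : ∑3 P6 ≡ triangles s
    e6 = trans (∑3-swap₁₂ P6) (trans (∑3-swap₂₃ _) (trans (∑3-swap₁₂ _) (∑3-cong λ x y z →
           cong (lt x y * lt y z *_) (trans (triIn-swap₁₂ s z y x) (trans (triIn-swap₂₃ s y z x) (triIn-swap₁₂ s y x z))))))

  everything : VertexSet
  everything _ = true

  triangleCount≡triangles : triangleCount G ≡ triangles everything
  triangleCount≡triangles = trans (length-filter-triples (isOrderedTriangle? G)) (∑3-cong λ x y z →
    trans {j = χ ((x <?F y) ×-dec (y <?F z)) * χ (adj? G x y ×-dec (adj? G y z ×-dec adj? G x z))} (χ-× ((x <?F y) ×-dec (y <?F z)) (adj? G x y ×-dec (adj? G y z ×-dec adj? G x z)))
    (trans (cong₂ _*_ (χ-× (x <?F y) (y <?F z)) (trans (χ-× (adj? G x y) (adj? G y z ×-dec adj? G x z)) (cong (A x y *_) (χ-× (adj? G y z) (adj? G x z)))))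
     (rearrange (lt x y) (lt y z) (A x y) (A y z) (A x z))))
    where
    rearrange : ∀ a b c d e → a * b * (c * (d * e)) ≡ a * b * (1 * 1 * 1 * (c * d * e))
    rearrange = solve-∀

  remove : VertexSet → Fin n → VertexSet
  remove s v x = if does (x ≟F v) then false else s x

  remove-∈ : ∀ {s v u} → s u ≡ true → u ≢ v → remove s v u ≡ true
  remove-∈ {v = v} {u} u∈s u≢v with u ≟F v
  ... | yes u≡v = ⊥-elim (u≢v u≡v)
  ... | no _ = u∈s

  ∈⇒member≡1 : ∀ s v → s v ≡ true → member s v ≡ 1
  ∈⇒member≡1 s v e = cong (λ b → if b then 1 else 0) e

  member-split : ∀ s v → s v ≡ true → ∀ x → member s x ≡ member (remove s v) x + δ v x
  member-split s v v∈s x with x ≟F v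
  ... | yes refl rewrite v∈s = refl
  ... | no _ = sym (+-identityʳ _)

  private
    TriInRemove : VertexSet → Fin n → Fin n → Fin n → Fin n → Set
    TriInRemove s v x y z =
      member s x * member s y * member s z * tri x y z
        ≡ member (remove s v) x * member (remove s v) y * member (remove s v) z * tri x y z
          + δ v x * (member s y * member s z * tri x y z) + δ v y * (member s x * member s z * tri x y z)
          + δ v z * (member s x * member s y * tri x y z)

    triIn-remove-degenerate : ∀ s v x y z → tri x y z ≡ 0 → TriInRemove s v x y z
    triIn-remove-degenerate s v x y z t≡0 rewrite t≡0 =
      zeros (member s x) (member s y) (member s z) (member (remove s v) x) (member (remove s v) y) (member (remove s v) z)
            (δ v x) (δ v y) (δ v z)
      where
      zeros : ∀ a b c a' b' c' dx dy dz → a * b * c * 0 ≡ a' * b' * c' * 0 + dx * (b * c * 0) + dy * (a * c * 0) + dz * (a * b * 0)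
      zeros = solve-∀

    -- At most one of x, y, z is v; the case splits make every δ a literal.
    triIn-remove-distinct : ∀ s v → s v ≡ true → ∀ x y z → x ≢ y → y ≢ z → x ≢ z → TriInRemove s v x y z
    triIn-remove-distinct s v v∈s x y z x≢y y≢z x≢z
      rewrite member-split s v v∈s x | member-split s v v∈s y | member-split s v v∈s z
      with x ≟F v | y ≟F v | z ≟F v
    ... | yes refl | yes refl | _ = ⊥-elim (x≢y refl)
    ... | yes refl | _ | yes refl = ⊥-elim (x≢z refl)
    ... | _ | yes refl | yes refl = ⊥-elim (y≢z refl)
    ... | yes refl | no _ | no _ = removed-x (member s y) (member s z) (tri v y z)
      where
      removed-x : ∀ b c t → (0 + 1) * (b + 0) * (c + 0) * t
                    ≡ 0 * b * c * t + 1 * ((b + 0) * (c + 0) * t) + 0 * ((0 + 1) * (c + 0) * t) + 0 * ((0 + 1) * (b + 0) * t)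
      removed-x = solve-∀
    ... | no _ | yes refl | no _ = removed-y (member s x) (member s z) (tri x v z)
      where
      removed-y : ∀ a c t → (a + 0) * (0 + 1) * (c + 0) * t
                    ≡ a * 0 * c * t + 0 * ((0 + 1) * (c + 0) * t) + 1 * ((a + 0) * (c + 0) * t) + 0 * ((a + 0) * (0 + 1) * t)
      removed-y = solve-∀
    ... | no _ | no _ | yes refl = removed-z (member s x) (member s y) (tri x y v)
      where
      removed-z : ∀ a b t → (a + 0) * (b + 0) * (0 + 1) * t
                    ≡ a * b * 0 * t + 0 * ((b + 0) * (0 + 1) * t) + 0 * ((a + 0) * (0 + 1) * t) + 1 * ((a + 0) * (b + 0) * t)
      removed-z = solve-∀
    ... | no _ | no _ | no _ = untouched (member s x) (member s y) (member s z) (tri x y z)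
      where
      untouched : ∀ a b c t → (a + 0) * (b + 0) * (c + 0) * t
                    ≡ a * b * c * t + 0 * ((b + 0) * (c + 0) * t) + 0 * ((a + 0) * (c + 0) * t) + 0 * ((a + 0) * (b + 0) * t)
      untouched = solve-∀

  triIn-remove : ∀ s v → s v ≡ true → ∀ x y z →
    triIn s x y z ≡ triIn (remove s v) x y z + δ v x * (member s y * member s z * tri x y z)
                   + δ v y * (member s x * member s z * tri x y z) + δ v z * (member s x * member s y * tri x y z)
  triIn-remove s v v∈s x y z with x ≟F y | y ≟F z | x ≟F z
  ... | yes refl | _ | _ = triIn-remove-degenerate s v x x z (tri-xxz x z)
  ... | _ | yes refl | _ = triIn-remove-degenerate s v x y y (tri-xyy x y)
  ... | _ | _ | yes refl = triIn-remove-degenerate s v x y x (tri-xyx x y)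
  ... | no x≢y | no y≢z | no x≢z = triIn-remove-distinct s v v∈s x y z x≢y y≢z x≢z

  trianglesAt : VertexSet → Fin n → ℕ
  trianglesAt s v = ∑ λ y → ∑ λ z → member s y * member s z * tri v y z

  ∑3-δ : ∀ v (H : Fin n → Fin n → Fin n → ℕ) → ∑3 (λ x y z → δ v x * H x y z) ≡ ∑ λ y → ∑ λ z → H v y z
  ∑3-δ v H = trans (∑-cong λ x → trans (∑-cong λ y → ∑-*ˡ (δ v x) (H x y)) (∑-*ˡ (δ v x) (λ y → ∑ (H x y))))
    (∑-δ v (λ x → ∑ λ y → ∑ (H x y)))

  ordTriangles-remove : ∀ s v → s v ≡ true → ordTriangles s ≡ ordTriangles (remove s v) + 3 * trianglesAt s v
  ordTriangles-remove s v v∈s = begin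
      ∑3 (triIn s)
    ≡⟨ ∑3-cong (triIn-remove s v v∈s) ⟩
      ∑3 (λ x y z → triIn (remove s v) x y z + Q1 x y z + Q2 x y z + Q3 x y z)
    ≡⟨ trans (∑3-+ _ Q3) (cong (_+ ∑3 Q3) (trans (∑3-+ _ Q2) (cong (_+ ∑3 Q2) (∑3-+ (triIn (remove s v)) Q1)))) ⟩
      ordTriangles (remove s v) + ∑3 Q1 + ∑3 Q2 + ∑3 Q3
    ≡⟨ cong₂ (λ a b → ordTriangles (remove s v) + ∑3 Q1 + a + b) e2 e3 ⟩
      ordTriangles (remove s v) + ∑3 Q1 + ∑3 Q1 + ∑3 Q1
    ≡⟨ cong (λ a → ordTriangles (remove s v) + a + a + a) e1 ⟩
      ordTriangles (remove s v) + trianglesAt s v + trianglesAt s v + trianglesAt s v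
    ≡⟨ rearrange (ordTriangles (remove s v)) (trianglesAt s v) ⟩
      ordTriangles (remove s v) + 3 * trianglesAt s v ∎
    where
    open ≡-Reasoning
    Q1 Q2 Q3 : Fin n → Fin n → Fin n → ℕ
    Q1 x y z = δ v x * (member s y * member s z * tri x y z)
    Q2 x y z = δ v y * (member s x * member s z * tri x y z)
    Q3 x y z = δ v z * (member s x * member s y * tri x y z)
    rearrange : ∀ a b → a + b + b + b ≡ a + 3 * b
    rearrange = solve-∀
    e1 : ∑3 Q1 ≡ trianglesAt s v
    e1 = ∑3-δ v (λ x y z → member s y * member s z * tri x y z)
    e2 : ∑3 Q2 ≡ ∑3 Q1
    e2 = trans (∑3-swap₁₂ Q2) (∑3-cong λ x y z → cong (λ t → δ v x * (member s y * member s z * t)) (tri-swap₁₂ y x z))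
    e3 : ∑3 Q3 ≡ ∑3 Q1
    e3 = trans (∑3-swap₂₃ Q3) (trans (∑3-swap₁₂ _) (∑3-cong λ x y z → cong (λ t → δ v x * (member s y * member s z * t))
           (trans (tri-swap₂₃ y z x) (tri-swap₁₂ y x z))))

  size : VertexSet → ℕ
  size s = ∑ (member s)

  size-remove : ∀ s v → s v ≡ true → size s ≡ suc (size (remove s v))
  size-remove s v v∈s = begin
    ∑ (member s)                                  ≡⟨ ∑-cong (member-split s v v∈s) ⟩
    ∑ (λ x → member (remove s v) x + δ v x)       ≡⟨ ∑-distrib-+ (member (remove s v)) (δ v) ⟩
    size (remove s v) + ∑ (δ v)                   ≡⟨ cong (size (remove s v) +_) (∑-δ-1 v) ⟩
    size (remove s v) + 1                         ≡⟨ +-comm _ 1 ⟩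
    suc (size (remove s v))                       ∎
    where open ≡-Reasoning

  occ : List (Fin n) → Fin n → ℕ
  occ [] y = 0
  occ (u ∷ L) y = δ u y + occ L y

  ∑List : List (Fin n) → (Fin n → ℕ) → ℕ
  ∑List [] g = 0
  ∑List (u ∷ L) g = g u + ∑List L g

  ∑-occ : ∀ L (g : Fin n → ℕ) → ∑ (λ y → occ L y * g y) ≡ ∑List L g
  ∑-occ [] g = sum-replicate-zero n
  ∑-occ (u ∷ L) g = trans (∑-cong λ y → *-distribʳ-+ (g y) (δ u y) (occ L y))
    (trans (∑-distrib-+ (λ y → δ u y * g y) (λ y → occ L y * g y)) (cong₂ _+_ (∑-δ u g) (∑-occ L g)))

  ∑∑-occ : ∀ L (f : Fin n → Fin n → ℕ) → ∑ (λ y → ∑ (λ z → occ L y * occ L z * f y z)) ≡ ∑List L (λ u → ∑List L (f u))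
  ∑∑-occ L f = trans (∑-cong λ y → trans (∑-cong λ z → *-assoc (occ L y) (occ L z) (f y z))
    (trans (∑-*ˡ (occ L y) (λ z → occ L z * f y z)) (cong (occ L y *_) (∑-occ L (f y)))))
    (∑-occ L (λ u → ∑List L (f u)))

  outerTriangles : (Fin n → ℕ) → Fin n → ℕ
  outerTriangles out v = ∑ λ y → ∑ λ z → out y * out z * tri v y z

  no-mixed-triangles : ∀ (out : Fin n → ℕ) v L → All (λ u → ∀ y → out y * tri v y u ≡ 0) L →
         ∀ y z → out y * occ L z * tri v y z ≡ 0
  no-mixed-triangles out v [] [] y z rewrite *-zeroʳ (out y) = refl
  no-mixed-triangles out v (u ∷ L) (h ∷ hs) y z = trans (cong (_* tri v y z) (*-distribˡ-+ (out y) (δ u z) (occ L z)))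
    (trans (*-distribʳ-+ (tri v y z) (out y * δ u z) (out y * occ L z))
    (cong₂ _+_ (first (z ≟F u)) (no-mixed-triangles out v L hs y z)))
    where
    first : Dec (z ≡ u) → out y * δ u z * tri v y z ≡ 0
    first (yes refl) = trans (cong (λ e → out y * e * tri v y u) (δ-self u)) (trans (cong (_* tri v y u) (*-identityʳ (out y))) (h y))
    first (no ne) = trans (cong (λ e → out y * e * tri v y z) (≢⇒δ≡0 ne)) (cong (_* tri v y z) (*-zeroʳ (out y)))

  trianglesAt-split : ∀ s (out : Fin n → ℕ) v L → (∀ y → member s y ≡ out y + occ L y) →
           (∀ y z → out y * occ L z * tri v y z ≡ 0) →
           trianglesAt s v ≡ ∑List L (λ u → ∑List L (λ w → tri v u w)) + outerTriangles out v
  trianglesAt-split s out v L hι hm = trans (∑-cong λ y → ∑-cong λ z → pt y z)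
    (trans (∑-cong λ y → ∑-distrib-+ (λ z → occ L y * occ L z * tri v y z) (λ z → out y * out z * tri v y z))
    (trans (∑-distrib-+ (λ y → ∑ λ z → occ L y * occ L z * tri v y z) (λ y → ∑ λ z → out y * out z * tri v y z))
    (cong (_+ outerTriangles out v) (∑∑-occ L (tri v)))))
    where
    ex : ∀ a b c d t → (a + b) * (c + d) * t ≡ b * d * t + a * c * t + a * d * t + c * b * t
    ex = solve-∀
    pt : ∀ y z → member s y * member s z * tri v y z ≡ occ L y * occ L z * tri v y z + out y * out z * tri v y z
    pt y z rewrite hι y | hι z = trans (ex (out y) (occ L y) (out z) (occ L z) (tri v y z))
      (trans (cong₂ (λ p q → occ L y * occ L z * tri v y z + out y * out z * tri v y z + p + q) (hm y z)
         (trans (cong (out z * occ L y *_) (tri-swap₂₃ v y z)) (hm z y)))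
       (trans (+-identityʳ _) (+-identityʳ _)))

  record IsK4 (a b c d : Fin n) : Set where
    field
      ab : Adj G a b
      ac : Adj G a c
      ad : Adj G a d
      bc : Adj G b c
      bd : Adj G b d
      cd : Adj G c d

  IsK4-swap₁₂ : ∀ {a b c d} → IsK4 a b c d → IsK4 b a c d
  IsK4-swap₁₂ K = record { ab = Graph.sym G K.ab ; ac = K.bc ; ad = K.bd ; bc = K.ac ; bd = K.ad ; cd = K.cd }
    where module K = IsK4 K

  IsK4-swap₂₃ : ∀ {a b c d} → IsK4 a b c d → IsK4 a c b d
  IsK4-swap₂₃ K = record { ab = K.ac ; ac = K.ab ; ad = K.ad ; bc = Graph.sym G K.bc ; bd = K.cd ; cd = K.bd }
    where module K = IsK4 K

  IsK4-swap₃₄ : ∀ {a b c d} → IsK4 a b c d → IsK4 a b d c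
  IsK4-swap₃₄ K = record { ab = K.ab ; ac = K.ad ; ad = K.ac ; bc = K.bd ; bd = K.bc ; cd = Graph.sym G K.cd }
    where module K = IsK4 K

  InK4 : Fin n → Fin n → Fin n → Fin n → Fin n → Set
  InK4 a b c d y = y ≡ a ⊎ y ≡ b ⊎ y ≡ c ⊎ y ≡ d

  adj≢ : ∀ {x y} → Adj G x y → x ≢ y
  adj≢ p refl = Graph.irrefl G p

  triangle⇒tri≡1 : ∀ {x y z} → Adj G x y → Adj G y z → Adj G x z → tri x y z ≡ 1
  triangle⇒tri≡1 p q r = cong₂ _*_ (cong₂ _*_ (Adj⇒A≡1 p) (Adj⇒A≡1 q)) (Adj⇒A≡1 r)

  tri>0⇒triangle : ∀ x y z → 0 < tri x y z → Adj G x y × Adj G y z × Adj G x z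
  tri>0⇒triangle x y z h = A>0⇒Adj (m*n>0⇒m>0 (A x y) (A y z) h1) , A>0⇒Adj (m*n>0⇒n>0 (A x y) (A y z) h1) , A>0⇒Adj (m*n>0⇒n>0 (A x y * A y z) (A x z) h)
    where
    h1 : 0 < A x y * A y z
    h1 = m*n>0⇒m>0 (A x y * A y z) (A x z) h

  member>0⇒∈ : ∀ s x → 0 < member s x → s x ≡ true
  member>0⇒∈ s x h with s x
  ... | true = refl
  ... | false with h
  ... | ()

  occ-outside : ∀ s (out : Fin n → ℕ) L → (∀ y → member s y ≡ out y + occ L y) → ∀ y → 0 < out y → occ L y ≡ 0
  occ-outside s out L h y p = a>0∧a+b≤1⇒b≡0 (out y) (occ L y) p (subst (_≤ 1) (h y) (member≤1 s y))
    where
    a>0∧a+b≤1⇒b≡0 : ∀ a b → 0 < a → a + b ≤ 1 → b ≡ 0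
    a>0∧a+b≤1⇒b≡0 (suc zero) zero _ _ = refl
    a>0∧a+b≤1⇒b≡0 (suc zero) (suc b) _ (s≤s ())
    a>0∧a+b≤1⇒b≡0 (suc (suc a)) b _ (s≤s ())

  occ-head-∈ : ∀ s (out : Fin n → ℕ) u L → (∀ y → member s y ≡ out y + occ (u ∷ L) y) → s u ≡ true
  occ-head-∈ s out u L h = member>0⇒∈ s u (subst (0 <_) (sym (h u)) (subst (λ e → 0 < out u + (e + occ L u)) (sym (δ-self u)) (≤-trans (s≤s z≤n) (m≤n+m (suc (occ L u)) (out u)))))

  member-remove-head : ∀ s (out : Fin n → ℕ) u L → (h : ∀ y → member s y ≡ out y + occ (u ∷ L) y) → ∀ y → member (remove s u) y ≡ out y + occ L y
  member-remove-head s out u L h y = +-cancelʳ-≡ (δ u y) (member (remove s u) y) (out y + occ L y)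
    (trans (sym (member-split s u (occ-head-∈ s out u L h) y)) (trans (h y) (reorder (out y) (δ u y) (occ L y))))
    where
    reorder : ∀ a b c → a + (b + c) ≡ a + c + b
    reorder = solve-∀

  no-mixed-triangles-self : ∀ (out : Fin n → ℕ) v → ∀ y → out y * tri v y v ≡ 0
  no-mixed-triangles-self out v y rewrite tri-xyx v y = *-zeroʳ (out y)

  outerDegree : (Fin n → ℕ) → Fin n → ℕ
  outerDegree out v = ∑ λ y → out y * A v y

  outerTriangles+outerDegree≤outerDegree² : ∀ (out : Fin n → ℕ) → (∀ y → out y ≤ 1) → ∀ v → outerTriangles out v + outerDegree out v ≤ outerDegree out v * outerDegree out v
  outerTriangles+outerDegree≤outerDegree² out out≤1 v = begin
      outerTriangles out v + outerDegree out v
    ≡⟨ cong₂ _+_ (∑-cong λ y → ∑-cong λ z → rearr (out y) (out z) (A v y) (A y z) (A v z))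
                 (∑-cong λ y → sym (m≤1⇒m*m≡m (o y) (o≤1 y))) ⟩
      ∑ (λ y → ∑ λ z → o y * o z * A y z) + ∑ (λ y → o y * o y)
    ≡⟨ sym (∑-distrib-+ (λ y → ∑ λ z → o y * o z * A y z) (λ y → o y * o y)) ⟩
      ∑ (λ y → ∑ (λ z → o y * o z * A y z) + o y * o y)
    ≤⟨ ∑-mono (λ y → inner y) ⟩
      ∑ (λ y → o y * outerDegree out v)
    ≡⟨ ∑-*ʳ (outerDegree out v) o ⟩
      outerDegree out v * outerDegree out v ∎
    where
    open ≤-Reasoning
    o : Fin n → ℕ
    o y = out y * A v y
    o≤1 : ∀ y → o y ≤ 1
    o≤1 y = *-≤1 (out≤1 y) (A≤1 v y)
    rearr : ∀ a b c d e → a * b * (c * d * e) ≡ a * c * (b * e) * d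
    rearr = solve-∀
    pt : ∀ y z → o y * o z * A y z + δ y z * (o y * o z) ≤ o y * o z
    pt y z with z ≟F y
    ... | yes refl rewrite A-irrefl z | *-zeroʳ (o z * o z) = ≤-reflexive (+-identityʳ _)
    ... | no ne rewrite +-identityʳ (o y * o z * A y z) = subst (o y * o z * A y z ≤_) (*-identityʳ (o y * o z)) (*-monoʳ-≤ (o y * o z) (A≤1 y z))
    inner : ∀ y → ∑ (λ z → o y * o z * A y z) + o y * o y ≤ o y * outerDegree out v
    inner y = begin
        ∑ (λ z → o y * o z * A y z) + o y * o y
      ≡⟨ cong (∑ (λ z → o y * o z * A y z) +_) (sym (∑-δ y (λ z → o y * o z))) ⟩
        ∑ (λ z → o y * o z * A y z) + ∑ (λ z → δ y z * (o y * o z))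
      ≡⟨ sym (∑-distrib-+ (λ z → o y * o z * A y z) (λ z → δ y z * (o y * o z))) ⟩
        ∑ (λ z → o y * o z * A y z + δ y z * (o y * o z))
      ≤⟨ ∑-mono (pt y) ⟩
        ∑ (λ z → o y * o z)
      ≡⟨ ∑-*ˡ (o y) o ⟩
        o y * outerDegree out v ∎

  module _ (s : VertexSet) where

    commonNbrs : Fin n → Fin n → ℕ
    commonNbrs x y = ∑ λ z → member s z * (A x z * A y z)

    commonNbrs-sym : ∀ x y → commonNbrs x y ≡ commonNbrs y x
    commonNbrs-sym x y = ∑-cong λ z → cong (member s z *_) (*-comm (A x z) (A y z))

    -- An edge xy lying in a single triangle xyw of s is selected unless w is the largest vertex of that triangle
    -- and xw, yw also lie in a single triangle; then every triangle of s has exactly two selected edges.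
    Shadowed : Fin n → Fin n → Set
    Shadowed x y = Σ[ w ∈ Fin n ] (s w ≡ true × Adj G x w × Adj G y w × x <F w × y <F w × commonNbrs x w ≡ 1 × commonNbrs y w ≡ 1)

    Shadowed? : ∀ x y → Dec (Shadowed x y)
    Shadowed? x y = any? λ w → (s w ≟B true) ×-dec adj? G x w ×-dec adj? G y w ×-dec (x <?F w) ×-dec (y <?F w) ×-dec (commonNbrs x w ≟ 1) ×-dec (commonNbrs y w ≟ 1)

    Shadowed-sym : ∀ {x y} → Shadowed x y → Shadowed y x
    Shadowed-sym (w , a , b , c , d , e , f , g) = w , a , c , b , e , d , g , f

    Selected : Fin n → Fin n → Set
    Selected x y = s x ≡ true × s y ≡ true × Adj G x y × commonNbrs x y ≡ 1 × ¬ Shadowed x y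

    Selected? : ∀ x y → Dec (Selected x y)
    Selected? x y = (s x ≟B true) ×-dec (s y ≟B true) ×-dec adj? G x y ×-dec (commonNbrs x y ≟ 1) ×-dec ¬? (Shadowed? x y)

    Selected-sym : ∀ {x y} → Selected x y → Selected y x
    Selected-sym {x} {y} (a , b , c , d , e) = b , a , Graph.sym G c , trans (commonNbrs-sym y x) d , λ z → e (Shadowed-sym z)

    selected : Fin n → Fin n → ℕ
    selected x y = χ (Selected? x y)

  K4Free : VertexSet → Set
  K4Free s = ∀ {a b c d} → s a ≡ true → s b ≡ true → s c ≡ true → s d ≡ true → IsK4 a b c d → ⊥

  record TriangleIn (s : VertexSet) (x y z : Fin n) : Set where
    constructor mkT
    field
      sx : s x ≡ true
      sy : s y ≡ true
      sz : s z ≡ true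
      xy : Adj G x y
      yz : Adj G y z
      xz : Adj G x z

  TriangleIn-swap₁₂ : ∀ {s x y z} → TriangleIn s x y z → TriangleIn s y x z
  TriangleIn-swap₁₂ (mkT a b c p q r) = mkT b a c (Graph.sym G p) r q
  TriangleIn-swap₂₃ : ∀ {s x y z} → TriangleIn s x y z → TriangleIn s x z y
  TriangleIn-swap₂₃ (mkT a b c p q r) = mkT a c b r (Graph.sym G q) p
  TriangleIn-rotate : ∀ {s x y z} → TriangleIn s x y z → TriangleIn s y z x
  TriangleIn-rotate t = TriangleIn-swap₂₃ (TriangleIn-swap₁₂ t)

  triIn>0⇒TriangleIn : ∀ s x y z → 0 < triIn s x y z → TriangleIn s x y z
  triIn>0⇒TriangleIn s x y z h = mkT (member>0⇒∈ s x hx) (member>0⇒∈ s y hy) (member>0⇒∈ s z hz) (proj₁ tp) (proj₁ (proj₂ tp)) (proj₂ (proj₂ tp))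
    where
    h3 = m*n>0⇒m>0 (member s x * member s y * member s z) (tri x y z) h
    h2 = m*n>0⇒m>0 (member s x * member s y) (member s z) h3
    hx = m*n>0⇒m>0 (member s x) (member s y) h2
    hy = m*n>0⇒n>0 (member s x) (member s y) h2
    hz = m*n>0⇒n>0 (member s x * member s y) (member s z) h3
    tp = tri>0⇒triangle x y z (m*n>0⇒n>0 (member s x * member s y * member s z) (tri x y z) h)

  triIn≤1 : ∀ s x y z → triIn s x y z ≤ 1
  triIn≤1 s x y z = *-≤1 (*-≤1 (*-≤1 (member≤1 s x) (member≤1 s y)) (member≤1 s z)) (*-≤1 (*-≤1 (A≤1 x y) (A≤1 y z)) (A≤1 x z))

  occ-∉ : ∀ u L → All (λ w → u ≢ w) L → occ L u ≡ 0
  occ-∉ u [] [] = refl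
  occ-∉ u (w ∷ L) (ne ∷ nes) rewrite ≢⇒δ≡0 {v = w} {u} ne = occ-∉ u L nes

  occ-∷-≤member : ∀ s u L → s u ≡ true → All (λ w → u ≢ w) L → (∀ x → occ L x ≤ member s x) → ∀ x → occ (u ∷ L) x ≤ member s x
  occ-∷-≤member s u L su nes h x with x ≟F u
  ... | yes refl = ≤-reflexive (trans (cong (1 +_) (occ-∉ u L nes)) (sym (∈⇒member≡1 s u su)))
  ... | no ne = h x

  ∑-occ-length : ∀ L → ∑ (occ L) ≡ length L
  ∑-occ-length L = trans (∑-cong λ y → sym (*-identityʳ (occ L y))) (trans (∑-occ L (λ _ → 1)) (∑List-1 L))
    where
    ∑List-1 : ∀ L → ∑List L (λ _ → 1) ≡ length L
    ∑List-1 [] = refl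
    ∑List-1 (u ∷ L) = cong suc (∑List-1 L)

  ordTriangles-remove-head : ∀ s (out : Fin n → ℕ) v L → (∀ y → member s y ≡ out y + occ (v ∷ L) y) →
    All (λ u → ∀ y → out y * tri v y u ≡ 0) (v ∷ L) →
    ordTriangles s ≡ ordTriangles (remove s v) + 3 * (∑List (v ∷ L) (λ u → ∑List (v ∷ L) (tri v u)) + outerTriangles out v)
  ordTriangles-remove-head s out v L split no-mixed =
    trans (ordTriangles-remove s v (occ-head-∈ s out v L split))
          (cong (λ e → ordTriangles (remove s v) + 3 * e)
                (trianglesAt-split s out v (v ∷ L) split (no-mixed-triangles out v (v ∷ L) no-mixed)))

  out>0⇒∉K4 : ∀ s (out : Fin n → ℕ) {i j k l} → (∀ y → member s y ≡ out y + occ (i ∷ j ∷ k ∷ l ∷ []) y) →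
    ∀ y → 0 < out y → y ≢ i × y ≢ j × y ≢ k × y ≢ l
  out>0⇒∉K4 s out {i} {j} {k} {l} split y y∈out =
    δ≡0⇒≢ (m+n≡0⇒m≡0 (δ i y) occ≡0) ,
    δ≡0⇒≢ (m+n≡0⇒m≡0 (δ j y) (m+n≡0⇒n≡0 (δ i y) occ≡0)) ,
    δ≡0⇒≢ (m+n≡0⇒m≡0 (δ k y) (m+n≡0⇒n≡0 (δ j y) (m+n≡0⇒n≡0 (δ i y) occ≡0))) ,
    δ≡0⇒≢ (m+n≡0⇒m≡0 (δ l y) (m+n≡0⇒n≡0 (δ k y) (m+n≡0⇒n≡0 (δ j y) (m+n≡0⇒n≡0 (δ i y) occ≡0))))
    where
    occ≡0 = occ-outside s out (i ∷ j ∷ k ∷ l ∷ []) split y y∈out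

  outerTriangles>0⇒edge : ∀ (out : Fin n → ℕ) v → 0 < outerTriangles out v →
    ∃ λ y → ∃ λ z → 0 < out y × 0 < out z × Adj G v y × Adj G v z × Adj G y z
  outerTriangles>0⇒edge out v pos =
    let y , pos-y = ∑>0⇒∃>0 (λ y → ∑ λ z → out y * out z * tri v y z) pos
        z , pos-yz = ∑>0⇒∃>0 (λ z → out y * out z * tri v y z) pos-y
        oo>0 = m*n>0⇒m>0 (out y * out z) (tri v y z) pos-yz
        (vy , yz , vz) = tri>0⇒triangle v y z (m*n>0⇒n>0 (out y * out z) (tri v y z) pos-yz)
    in y , z , m*n>0⇒m>0 (out y) (out z) oo>0 , m*n>0⇒n>0 (out y) (out z) oo>0 , vy , vz , yz

  K4-covers-size-4 : ∀ T → size T ≡ 4 → ∀ {p q r t} → T p ≡ true → T q ≡ true → T r ≡ true → T t ≡ true →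
    IsK4 p q r t → ∀ {w} → T w ≡ true → InK4 p q r t w
  K4-covers-size-4 T size≡4 {p} {q} {r} {t} pT qT rT tT K {w} wT with w ≟F p | w ≟F q | w ≟F r | w ≟F t
  ... | yes e | _ | _ | _ = inj₁ e
  ... | no _ | yes e | _ | _ = inj₂ (inj₁ e)
  ... | no _ | no _ | yes e | _ = inj₂ (inj₂ (inj₁ e))
  ... | no _ | no _ | no _ | yes e = inj₂ (inj₂ (inj₂ e))
  ... | no w≢p | no w≢q | no w≢r | no w≢t = ⊥-elim (1+n≰n {4} (subst (5 ≤_) size≡4 (begin
      5                ≡˘⟨ ∑-occ-length five ⟩
      ∑ (occ five)     ≤⟨ ∑-mono five≤T ⟩
      size T           ∎)))
    where
    open ≤-Reasoning
    module K = IsK4 K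
    five : List (Fin n)
    five = p ∷ q ∷ r ∷ t ∷ w ∷ []
    five≤T : ∀ x → occ five x ≤ member T x
    five≤T = occ-∷-≤member T p (q ∷ r ∷ t ∷ w ∷ []) pT (adj≢ K.ab ∷ adj≢ K.ac ∷ adj≢ K.ad ∷ ≢-sym w≢p ∷ [])
             (occ-∷-≤member T q (r ∷ t ∷ w ∷ []) qT (adj≢ K.bc ∷ adj≢ K.bd ∷ ≢-sym w≢q ∷ [])
             (occ-∷-≤member T r (t ∷ w ∷ []) rT (adj≢ K.cd ∷ ≢-sym w≢r ∷ [])
             (occ-∷-≤member T t (w ∷ []) tT (≢-sym w≢t ∷ [])
             (occ-∷-≤member T w [] wT [] (λ _ → z≤n)))))

module GemFree {n : ℕ} (G : Graph n) (ng : NoGem G) where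

  open Triangles G

  -- The gem has centre a and path y b c d.
  K4-two-nbrs : ∀ {a b c d y} → IsK4 a b c d → y ≢ c → y ≢ d → Adj G a y → Adj G b y → ⊥
  K4-two-nbrs K y≢c y≢d ay by = ng ay K.ab K.ac K.ad (Graph.sym G by) K.bc K.cd y≢c y≢d (adj≢ K.bd)
    where module K = IsK4 K

  K4-at-most-one-nbr : ∀ {a b c d y} → IsK4 a b c d → y ≢ a → y ≢ b → y ≢ c → y ≢ d →
    ∀ {u w} → InK4 a b c d u → InK4 a b c d w → u ≢ w → Adj G u y → Adj G w y → ⊥
  K4-at-most-one-nbr {y = y} K ya yb yc yd {u} {w} = pair
    where
    Kac = IsK4-swap₂₃ K
    Kad = IsK4-swap₂₃ (IsK4-swap₃₄ K)
    Kbc = IsK4-swap₂₃ (IsK4-swap₁₂ K)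
    Kbd = IsK4-swap₂₃ (IsK4-swap₁₂ (IsK4-swap₃₄ K))
    Kcd = IsK4-swap₂₃ (IsK4-swap₁₂ (IsK4-swap₃₄ (IsK4-swap₂₃ K)))
    pair : InK4 _ _ _ _ u → InK4 _ _ _ _ w → u ≢ w → Adj G u y → Adj G w y → ⊥
    pair (inj₁ refl) (inj₁ refl) u≢w _ _ = u≢w refl
    pair (inj₁ refl) (inj₂ (inj₁ refl)) _ uy wy = K4-two-nbrs K yc yd uy wy
    pair (inj₁ refl) (inj₂ (inj₂ (inj₁ refl))) _ uy wy = K4-two-nbrs Kac yb yd uy wy
    pair (inj₁ refl) (inj₂ (inj₂ (inj₂ refl))) _ uy wy = K4-two-nbrs Kad yb yc uy wy
    pair (inj₂ (inj₁ refl)) (inj₁ refl) _ uy wy = K4-two-nbrs K yc yd wy uy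
    pair (inj₂ (inj₁ refl)) (inj₂ (inj₁ refl)) u≢w _ _ = u≢w refl
    pair (inj₂ (inj₁ refl)) (inj₂ (inj₂ (inj₁ refl))) _ uy wy = K4-two-nbrs Kbc ya yd uy wy
    pair (inj₂ (inj₁ refl)) (inj₂ (inj₂ (inj₂ refl))) _ uy wy = K4-two-nbrs Kbd ya yc uy wy
    pair (inj₂ (inj₂ (inj₁ refl))) (inj₁ refl) _ uy wy = K4-two-nbrs Kac yb yd wy uy
    pair (inj₂ (inj₂ (inj₁ refl))) (inj₂ (inj₁ refl)) _ uy wy = K4-two-nbrs Kbc ya yd wy uy
    pair (inj₂ (inj₂ (inj₁ refl))) (inj₂ (inj₂ (inj₁ refl))) u≢w _ _ = u≢w refl
    pair (inj₂ (inj₂ (inj₁ refl))) (inj₂ (inj₂ (inj₂ refl))) _ uy wy = K4-two-nbrs Kcd ya yb uy wy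
    pair (inj₂ (inj₂ (inj₂ refl))) (inj₁ refl) _ uy wy = K4-two-nbrs Kad yb yc wy uy
    pair (inj₂ (inj₂ (inj₂ refl))) (inj₂ (inj₁ refl)) _ uy wy = K4-two-nbrs Kbd ya yc wy uy
    pair (inj₂ (inj₂ (inj₂ refl))) (inj₂ (inj₂ (inj₁ refl))) _ uy wy = K4-two-nbrs Kcd ya yb wy uy
    pair (inj₂ (inj₂ (inj₂ refl))) (inj₂ (inj₂ (inj₂ refl))) u≢w _ _ = u≢w refl

  no-mixed-triangles-K4 : ∀ (out : Fin n → ℕ) {v u p q} → IsK4 v u p q →
    (∀ y → 0 < out y → y ≢ p × y ≢ q) → ∀ y → out y * tri v y u ≡ 0
  no-mixed-triangles-K4 out K outside y = m>0⇒n≡0⇒m*n≡0 (out y) (tri _ y _) λ y∈out → n≤0⇒n≡0 (≮⇒≥ λ t>0 →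
    let (vy , yu , _) = tri>0⇒triangle _ y _ t>0 in
    K4-two-nbrs K (proj₁ (outside y y∈out)) (proj₂ (outside y y∈out)) vy (Graph.sym G yu))

  -- A K4 inside a 4-vertex set T would be all of T, so v would see two of its vertices.
  K4Free-size-4 : ∀ T {v y z} → size T ≡ 4 → T v ≡ false → T y ≡ true → T z ≡ true →
    Adj G v y → Adj G v z → Adj G y z → K4Free T
  K4Free-size-4 T {v} size≡4 vT yT zT vy vz yz pT qT rT tT K =
    K4-at-most-one-nbr K (v≢ pT) (v≢ qT) (v≢ rT) (v≢ tT) (cover yT) (cover zT) (adj≢ yz) (Graph.sym G vy) (Graph.sym G vz)
    where
    cover = K4-covers-size-4 T size≡4 pT qT rT tT K
    v≢ : ∀ {w} → T w ≡ true → v ≢ w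
    v≢ wT refl with () ← trans (sym vT) wT

  record Peeling (s : VertexSet) (out : Fin n → ℕ) (i j k l : Fin n) : Set where
    field
      ordTriangles-i : ordTriangles s ≡ ordTriangles (remove s i) + 3 * (6 + outerTriangles out i)
      ordTriangles-j : ordTriangles (remove s i) ≡ ordTriangles (remove (remove s i) j) + 3 * (2 + outerTriangles out j)
      ordTriangles-k : ordTriangles (remove (remove s i) j) ≡ ordTriangles (remove (remove (remove s i) j) k) + 3 * outerTriangles out k
      ordTriangles-l : ordTriangles (remove (remove (remove s i) j) k) ≡ ordTriangles (remove (remove (remove (remove s i) j) k) l) + 3 * outerTriangles out l
      size-i : size s ≡ suc (size (remove s i))
      size-j : size (remove s i) ≡ suc (size (remove (remove s i) j))
      size-k : size (remove (remove s i) j) ≡ suc (size (remove (remove (remove s i) j) k))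
      size-l : size (remove (remove (remove s i) j) k) ≡ suc (size (remove (remove (remove (remove s i) j) k) l))
      member-remainder : ∀ y → member (remove (remove (remove (remove s i) j) k) l) y ≡ out y + 0

  peeling : ∀ s (out : Fin n → ℕ) i j k l → IsK4 i j k l →
           (∀ y → member s y ≡ out y + occ (i ∷ j ∷ k ∷ l ∷ []) y) → Peeling s out i j k l
  peeling s out i j k l K split₀ = record
    { ordTriangles-i = trans (ordTriangles-remove-head s out i L1 split₀
                   (no-mixed-triangles-self out i ∷ no-mixed-triangles-K4 out K (λ y p → let (_ , _ , y≢k , y≢l) = outside y p in y≢k , y≢l)
                    ∷ no-mixed-triangles-K4 out (IsK4-swap₂₃ K) (λ y p → let (_ , y≢j , _ , y≢l) = outside y p in y≢j , y≢l)
                    ∷ no-mixed-triangles-K4 out (IsK4-swap₂₃ (IsK4-swap₃₄ K)) (λ y p → let (_ , y≢j , y≢k , _) = outside y p in y≢j , y≢k) ∷ []))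
                 (cong (λ e → ordTriangles S1 + 3 * (e + outerTriangles out i)) six-at-i)
    ; ordTriangles-j = trans (ordTriangles-remove-head S1 out j L2 h1
                   (no-mixed-triangles-self out j ∷ no-mixed-triangles-K4 out (IsK4-swap₂₃ (IsK4-swap₁₂ K)) (λ y p → let (y≢i , _ , _ , y≢l) = outside y p in y≢i , y≢l)
                    ∷ no-mixed-triangles-K4 out (IsK4-swap₂₃ (IsK4-swap₁₂ (IsK4-swap₃₄ K))) (λ y p → let (y≢i , _ , y≢k , _) = outside y p in y≢i , y≢k) ∷ []))
                 (cong (λ e → ordTriangles S2 + 3 * (e + outerTriangles out j)) two-at-j)
    ; ordTriangles-k = trans (ordTriangles-remove-head S2 out k L3 h2
                   (no-mixed-triangles-self out k
                    ∷ no-mixed-triangles-K4 out (IsK4-swap₂₃ (IsK4-swap₁₂ (IsK4-swap₃₄ (IsK4-swap₂₃ K)))) (λ y p → let (y≢i , y≢j , _ , _) = outside y p in y≢i , y≢j) ∷ []))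
                 (cong (λ e → ordTriangles S3 + 3 * (e + outerTriangles out k)) none-at-k)
    ; ordTriangles-l = trans (ordTriangles-remove-head S3 out l [] h3 (no-mixed-triangles-self out l ∷ []))
                 (cong (λ e → ordTriangles S4 + 3 * (e + outerTriangles out l)) none-at-l)
    ; size-i = size-remove s i (occ-head-∈ s out i L1 split₀)
    ; size-j = size-remove S1 j (occ-head-∈ S1 out j L2 h1)
    ; size-k = size-remove S2 k (occ-head-∈ S2 out k L3 h2)
    ; size-l = size-remove S3 l (occ-head-∈ S3 out l [] h3)
    ; member-remainder = member-remove-head S3 out l [] h3
    }
    where
    module K = IsK4 K
    L1 L2 L3 : List (Fin n)
    L1 = j ∷ k ∷ l ∷ []
    L2 = k ∷ l ∷ []
    L3 = l ∷ []
    S1 S2 S3 S4 : VertexSet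
    S1 = remove s i
    S2 = remove S1 j
    S3 = remove S2 k
    S4 = remove S3 l
    h1 = member-remove-head s out i L1 split₀
    h2 = member-remove-head S1 out j L2 h1
    h3 = member-remove-head S2 out k L3 h2
    outside : ∀ y → 0 < out y → y ≢ i × y ≢ j × y ≢ k × y ≢ l
    outside = out>0⇒∉K4 s out split₀
    six-at-i : ∑List (i ∷ j ∷ k ∷ l ∷ []) (λ u → ∑List (i ∷ j ∷ k ∷ l ∷ []) (λ w → tri i u w)) ≡ 6
    six-at-i rewrite tri-xxz i i | tri-xxz i j | tri-xxz i k | tri-xxz i l | tri-xyx i j | tri-xyy i j | triangle⇒tri≡1 K.ab K.bc K.ac | triangle⇒tri≡1 K.ab K.bd K.ad | tri-xyx i k | triangle⇒tri≡1 K.ac (Graph.sym G K.bc) K.ab | tri-xyy i k | triangle⇒tri≡1 K.ac K.cd K.ad | tri-xyx i l | triangle⇒tri≡1 K.ad (Graph.sym G K.bd) K.ab | triangle⇒tri≡1 K.ad (Graph.sym G K.cd) K.ac | tri-xyy i l = refl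
    two-at-j : ∑List (j ∷ k ∷ l ∷ []) (λ u → ∑List (j ∷ k ∷ l ∷ []) (λ w → tri j u w)) ≡ 2
    two-at-j rewrite tri-xxz j j | tri-xxz j k | tri-xxz j l | tri-xyx j k | tri-xyy j k | triangle⇒tri≡1 K.bc K.cd K.bd | tri-xyx j l | triangle⇒tri≡1 K.bd (Graph.sym G K.cd) K.bc | tri-xyy j l = refl
    none-at-k : ∑List (k ∷ l ∷ []) (λ u → ∑List (k ∷ l ∷ []) (λ w → tri k u w)) ≡ 0
    none-at-k rewrite tri-xxz k k | tri-xxz k l | tri-xyx k l | tri-xyy k l = refl
    none-at-l : ∑List (l ∷ []) (λ u → ∑List (l ∷ []) (λ w → tri l u w)) ≡ 0
    none-at-l rewrite tri-xxz l l = refl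

  outerDegrees≤ : ∀ (out : Fin n → ℕ) → (∀ y → out y ≤ 1) → ∀ a b c d → IsK4 a b c d →
    (∀ y → 0 < out y → y ≢ a × y ≢ b × y ≢ c × y ≢ d) →
    outerDegree out a + outerDegree out b + outerDegree out c + outerDegree out d ≤ ∑ out
  outerDegrees≤ out out≤1 a b c d K hout = begin
      outerDegree out a + outerDegree out b + outerDegree out c + outerDegree out d
    ≡⟨ sym (trans (∑-distrib-+ (λ y → out y * A a y + out y * A b y + out y * A c y) (λ y → out y * A d y))
          (cong (_+ outerDegree out d) (trans (∑-distrib-+ (λ y → out y * A a y + out y * A b y) (λ y → out y * A c y))
            (cong (_+ outerDegree out c) (∑-distrib-+ (λ y → out y * A a y) (λ y → out y * A b y)))))) ⟩
      ∑ (λ y → out y * A a y + out y * A b y + out y * A c y + out y * A d y)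
    ≤⟨ ∑-mono pt ⟩
      ∑ out ∎
    where
    open ≤-Reasoning
    module K = IsK4 K
    pt : ∀ y → out y * A a y + out y * A b y + out y * A c y + out y * A d y ≤ out y
    pt y with out y in eq
    ... | zero = z≤n
    ... | suc zero = subst (_≤ 1) (rearrange (A a y) (A b y) (A c y) (A d y))
            (at-most-one-of-four (adj? G a y) (adj? G b y) (adj? G c y) (adj? G d y) exab exac exad exbc exbd excd)
      where
      rearrange : ∀ p q r s → p + q + r + s ≡ 1 * p + 1 * q + 1 * r + 1 * s
      rearrange = solve-∀
      hy = hout y (subst (0 <_) (sym eq) (s≤s z≤n))
      ya = proj₁ hy
      yb = proj₁ (proj₂ hy)
      yc = proj₁ (proj₂ (proj₂ hy))
      yd = proj₂ (proj₂ (proj₂ hy))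
      one = K4-at-most-one-nbr K ya yb yc yd
      exab : Adj G a y → Adj G b y → ⊥
      exab = one (inj₁ refl) (inj₂ (inj₁ refl)) (adj≢ K.ab)
      exac : Adj G a y → Adj G c y → ⊥
      exac = one (inj₁ refl) (inj₂ (inj₂ (inj₁ refl))) (adj≢ K.ac)
      exad : Adj G a y → Adj G d y → ⊥
      exad = one (inj₁ refl) (inj₂ (inj₂ (inj₂ refl))) (adj≢ K.ad)
      exbc : Adj G b y → Adj G c y → ⊥
      exbc = one (inj₂ (inj₁ refl)) (inj₂ (inj₂ (inj₁ refl))) (adj≢ K.bc)
      exbd : Adj G b y → Adj G d y → ⊥
      exbd = one (inj₂ (inj₁ refl)) (inj₂ (inj₂ (inj₂ refl))) (adj≢ K.bd)
      excd : Adj G c y → Adj G d y → ⊥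
      excd = one (inj₂ (inj₂ (inj₁ refl))) (inj₂ (inj₂ (inj₂ refl))) (adj≢ K.cd)
    ... | suc (suc _) with s≤s () ← subst (_≤ 1) eq (out≤1 y)

  module K4FreeBound (s : VertexSet) (nok4 : K4Free s) where

    commonNbr : Fin n → Fin n → Fin n → ℕ
    commonNbr x y w = member s w * (A x w * A y w)

    commonNbr≡1 : ∀ {x y w} → s w ≡ true → Adj G x w → Adj G y w → commonNbr x y w ≡ 1
    commonNbr≡1 {x} {y} {w} sw p q = cong₂ _*_ (∈⇒member≡1 s w sw) (cong₂ _*_ (Adj⇒A≡1 p) (Adj⇒A≡1 q))

    commonNbrs≥1 : ∀ {x y w} → s w ≡ true → Adj G x w → Adj G y w → 1 ≤ commonNbrs s x y
    commonNbrs≥1 {x} {y} {w} sw p q = ≤-trans (≤-reflexive (sym (commonNbr≡1 sw p q))) (term≤∑ (commonNbr x y) w)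

    unique-common-nbr : ∀ {x y w w'} → commonNbrs s x y ≡ 1 → s w ≡ true → Adj G x w → Adj G y w → s w' ≡ true → Adj G x w' → Adj G y w' → w ≡ w'
    unique-common-nbr {x} {y} {w} {w'} e sw p q sw' p' q' with w ≟F w'
    ... | yes eq = eq
    ... | no ne = ⊥-elim (1+n≰n (subst (2 ≤_) e (2≤∑-of-two-positive (commonNbr x y) w w' ne
            (≤-reflexive (sym (commonNbr≡1 sw p q))) (≤-reflexive (sym (commonNbr≡1 sw' p' q'))))))

    other-common-nbr : ∀ x y z → 2 ≤ commonNbrs s x y → Σ[ w ∈ Fin n ] (w ≢ z × s w ≡ true × Adj G x w × Adj G y w)
    other-common-nbr x y z h with 2≤∑⇒∃-other-positive (commonNbr x y) z h (term≤1 z)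
      where
      term≤1 : ∀ w → commonNbr x y w ≤ 1
      term≤1 w = *-≤1 (member≤1 s w) (*-≤1 (A≤1 x w) (A≤1 y w))
    ... | w , ne , p = w , ne , member>0⇒∈ s w (m*n>0⇒m>0 (member s w) _ p) ,
          A>0⇒Adj (m*n>0⇒m>0 (A x w) (A y w) (m*n>0⇒n>0 (member s w) _ p)) ,
          A>0⇒Adj (m*n>0⇒n>0 (A x w) (A y w) (m*n>0⇒n>0 (member s w) _ p))

    no-two-heavy-edges : ∀ {c p q} → TriangleIn s c p q → 2 ≤ commonNbrs s c p → 2 ≤ commonNbrs s c q → ⊥
    no-two-heavy-edges {c} {p} {q} (mkT sc sp sq cp pq cq) h1 h2 with other-common-nbr c p q h1 | other-common-nbr c q p h2
    ... | w , wq , sw , cw , pw | u , up , su , cu , qu with w ≟F u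
    ... | yes refl = nok4 sc sp sq sw (record { ab = cp ; ac = cq ; ad = cw ; bc = pq ; bd = pw ; cd = qu })
    ... | no wu = ng cw cp cq cu (Graph.sym G pw) pq qu wq wu (λ e → up (sym e))

    Shadowed-characterisation : ∀ {x y z} → TriangleIn s x y z → commonNbrs s x y ≡ 1 → Shadowed s x y → x <F z × y <F z × commonNbrs s x z ≡ 1 × commonNbrs s y z ≡ 1
    Shadowed-characterisation (mkT sx sy sz xy yz xz) e (w , sw , xw , yw , a , b , c , d) with unique-common-nbr e sw xw yw sz xz yz
    ... | refl = a , b , c , d

    Selected⇒selected≡1 : ∀ {x y} → Selected s x y → selected s x y ≡ 1
    Selected⇒selected≡1 {x} {y} f = χ-yes (Selected? s x y) f

    ¬Selected⇒selected≡0 : ∀ {x y} → ¬ Selected s x y → selected s x y ≡ 0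
    ¬Selected⇒selected≡0 {x} {y} f = χ-no (Selected? s x y) f

    selected-if-other-heavy : ∀ {u v w} → TriangleIn s u v w → commonNbrs s u v ≡ 1 → (commonNbrs s u w ≢ 1 ⊎ commonNbrs s v w ≢ 1) → selected s u v ≡ 1
    selected-if-other-heavy t@(mkT su sv sw uv vw uw) e h = Selected⇒selected≡1 (su , sv , uv , e , λ d → case h (Shadowed-characterisation t e d))
      where
      case : (commonNbrs s _ _ ≢ 1 ⊎ commonNbrs s _ _ ≢ 1) → _ → ⊥
      case (inj₁ ne) (_ , _ , c1 , _) = ne c1
      case (inj₂ ne) (_ , _ , _ , c2) = ne c2

    selected-if-third-not-max : ∀ {u v w} → TriangleIn s u v w → commonNbrs s u v ≡ 1 → ¬ (u <F w × v <F w) → selected s u v ≡ 1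
    selected-if-third-not-max t@(mkT su sv sw uv vw uw) e h = Selected⇒selected≡1 (su , sv , uv , e , λ d → let (a , b , _ , _) = Shadowed-characterisation t e d in h (a , b))

    unselected-if-third-max : ∀ {u v w} → TriangleIn s u v w → commonNbrs s u w ≡ 1 → commonNbrs s v w ≡ 1 → u <F w → v <F w → selected s u v ≡ 0
    unselected-if-third-max {w = w} (mkT su sv sw uv vw uw) e1 e2 a b = ¬Selected⇒selected≡0 λ f → proj₂ (proj₂ (proj₂ (proj₂ f))) (w , sw , uw , vw , a , b , e1 , e2)

    unselected-if-heavy : ∀ {u v} → commonNbrs s u v ≢ 1 → selected s u v ≡ 0
    unselected-if-heavy ne = ¬Selected⇒selected≡0 λ f → ne (proj₁ (proj₂ (proj₂ (proj₂ f))))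

    commonNbrs-sym-≢1 : ∀ {x y} → commonNbrs s x y ≢ 1 → commonNbrs s y x ≢ 1
    commonNbrs-sym-≢1 {x} {y} ne e = ne (trans (commonNbrs-sym s x y) e)

    two-selected-edges : ∀ {x y z} → TriangleIn s x y z → selected s x y + selected s y z + selected s x z ≡ 2
    two-selected-edges {x} {y} {z} t = go (commonNbrs s x y ≟ 1) (commonNbrs s y z ≟ 1) (commonNbrs s x z ≟ 1)
      where
      open TriangleIn t
      g1 : 1 ≤ commonNbrs s x y
      g1 = commonNbrs≥1 sz xz yz
      g2 : 1 ≤ commonNbrs s y z
      g2 = commonNbrs≥1 sx (Graph.sym G xy) (Graph.sym G xz)
      g3 : 1 ≤ commonNbrs s x z
      g3 = commonNbrs≥1 sy xy (Graph.sym G yz)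
      sum-is : ∀ {a b c} → selected s x y ≡ a → selected s y z ≡ b → selected s x z ≡ c → a + b + c ≡ 2 → selected s x y + selected s y z + selected s x z ≡ 2
      sum-is refl refl refl e = e
      go : Dec (commonNbrs s x y ≡ 1) → Dec (commonNbrs s y z ≡ 1) → Dec (commonNbrs s x z ≡ 1) → selected s x y + selected s y z + selected s x z ≡ 2
      go (no a) (no b) _ = ⊥-elim (no-two-heavy-edges (TriangleIn-swap₁₂ t) (subst (2 ≤_) (commonNbrs-sym s x y) (≥1∧≢1⇒≥2 g1 a)) (≥1∧≢1⇒≥2 g2 b))
      go (no a) _ (no c) = ⊥-elim (no-two-heavy-edges t (≥1∧≢1⇒≥2 g1 a) (≥1∧≢1⇒≥2 g3 c))
      go _ (no b) (no c) = ⊥-elim (no-two-heavy-edges (TriangleIn-rotate (TriangleIn-rotate t)) (subst (2 ≤_) (commonNbrs-sym s x z) (≥1∧≢1⇒≥2 g3 c)) (subst (2 ≤_) (commonNbrs-sym s y z) (≥1∧≢1⇒≥2 g2 b)))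
      go (no a) (yes b) (yes c) = sum-is (unselected-if-heavy a) (selected-if-other-heavy (TriangleIn-rotate t) b (inj₁ (commonNbrs-sym-≢1 a))) (selected-if-other-heavy (TriangleIn-swap₂₃ t) c (inj₁ a)) refl
      go (yes a) (no b) (yes c) = sum-is (selected-if-other-heavy t a (inj₂ b)) (unselected-if-heavy b) (selected-if-other-heavy (TriangleIn-swap₂₃ t) c (inj₂ (commonNbrs-sym-≢1 b))) refl
      go (yes a) (yes b) (no c) = sum-is (selected-if-other-heavy t a (inj₁ c)) (selected-if-other-heavy (TriangleIn-rotate t) b (inj₂ (commonNbrs-sym-≢1 c))) (unselected-if-heavy c) refl
      go (yes a) (yes b) (yes c) with <F-cmp x y | <F-cmp y z | <F-cmp x z
      ... | tri≈ _ e _ | _ | _ = ⊥-elim (adj≢ xy e)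
      ... | _ | tri≈ _ e _ | _ = ⊥-elim (adj≢ yz e)
      ... | _ | _ | tri≈ _ e _ = ⊥-elim (adj≢ xz e)
      ... | _ | tri< yz' _ _ | tri< xz' _ _ = sum-is (unselected-if-third-max t c b xz' yz')
              (selected-if-third-not-max (TriangleIn-rotate t) b (λ pq → <F-asym xz' (proj₂ pq))) (selected-if-third-not-max (TriangleIn-swap₂₃ t) c (λ pq → <F-asym yz' (proj₂ pq))) refl
      ... | tri< xy' _ _ | tri> _ _ zy' | _ = sum-is (selected-if-third-not-max t a (λ pq → <F-asym zy' (proj₂ pq)))
              (selected-if-third-not-max (TriangleIn-rotate t) b (λ pq → <F-asym xy' (proj₁ pq))) (unselected-if-third-max (TriangleIn-swap₂₃ t) a (trans (commonNbrs-sym s z y) b) xy' zy') refl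
      ... | tri> _ _ yx' | _ | tri> _ _ zx' = sum-is (selected-if-third-not-max t a (λ pq → <F-asym zx' (proj₁ pq)))
              (unselected-if-third-max (TriangleIn-rotate t) (trans (commonNbrs-sym s y x) a) (trans (commonNbrs-sym s z x) c) yx' zx') (selected-if-third-not-max (TriangleIn-swap₂₃ t) c (λ pq → <F-asym yx' (proj₁ pq))) refl
      ... | tri< xy' _ _ | tri< yz' _ _ | tri> _ _ zx' = ⊥-elim (<F-asym zx' (<F-trans xy' yz'))
      ... | tri> _ _ yx' | tri> _ _ zy' | tri< xz' _ _ = ⊥-elim (<F-asym xz' (<F-trans zy' yx'))

    selectedPairs : ℕ
    selectedPairs = ∑ λ x → ∑ (selected s x)

    selected-edge-one-triangle : ∀ x y → ∑ (λ z → triIn s x y z) * selected s x y ≡ selected s x y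
    selected-edge-one-triangle x y = by-cases (Selected? s x y)
      where
      unit-factors : ∀ {a b c d e f} → a ≡ 1 → b ≡ 1 → d ≡ 1 → a * b * c * (d * e * f) ≡ c * (f * e)
      unit-factors {c = c} {e = e} {f = f} refl refl refl = rearrange c e f
        where
        rearrange : ∀ c e f → 1 * 1 * c * (1 * e * f) ≡ c * (f * e)
        rearrange = solve-∀
      by-cases : (p : Dec (Selected s x y)) → ∑ (triIn s x y) * χ p ≡ χ p
      by-cases (no _) = *-zeroʳ (∑ (triIn s x y))
      by-cases (yes (x∈s , y∈s , xy , unique , _)) = trans (*-identityʳ _) (trans (∑-cong triangle-through) unique)
        where
        triangle-through : ∀ z → triIn s x y z ≡ member s z * (A x z * A y z)
        triangle-through z = unit-factors (∈⇒member≡1 s x x∈s) (∈⇒member≡1 s y y∈s) (Adj⇒A≡1 xy)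

    ∑-triIn-selected₁₂ : ∑3 (λ x y z → triIn s x y z * selected s x y) ≡ selectedPairs
    ∑-triIn-selected₁₂ = ∑-cong λ x → trans (∑-cong λ y → trans (∑-*ʳ (selected s x y) (triIn s x y)) (selected-edge-one-triangle x y)) refl

    ∑-triIn-selected₂₃ : ∑3 (λ x y z → triIn s x y z * selected s y z) ≡ selectedPairs
    ∑-triIn-selected₂₃ = trans (∑3-swap₁₂ _) (trans (∑3-swap₂₃ _) (trans (∑3-cong λ x y z → cong (_* selected s x y) (trans (triIn-swap₁₂ s z x y) (triIn-swap₂₃ s x z y))) ∑-triIn-selected₁₂))

    ∑-triIn-selected₁₃ : ∑3 (λ x y z → triIn s x y z * selected s x z) ≡ selectedPairs
    ∑-triIn-selected₁₃ = trans (∑3-swap₂₃ _) (trans (∑3-cong λ x y z → cong (_* selected s x y) (triIn-swap₂₃ s x z y)) ∑-triIn-selected₁₂)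

    selected-edges-of-triangle : ∀ x y z → triIn s x y z * (selected s x y + selected s y z + selected s x z) ≡ 2 * triIn s x y z
    selected-edges-of-triangle x y z with triIn s x y z in eq
    ... | zero = refl
    ... | suc zero = trans (+-identityʳ _) (two-selected-edges (triIn>0⇒TriangleIn s x y z (subst (0 <_) (sym eq) (s≤s z≤n))))
    ... | suc (suc _) with s≤s () ← subst (_≤ 1) eq (triIn≤1 s x y z)

    3*selectedPairs≡2*ordTriangles : 3 * selectedPairs ≡ 2 * ordTriangles s
    3*selectedPairs≡2*ordTriangles = begin
        3 * selectedPairs
      ≡⟨ e3 selectedPairs ⟩
        selectedPairs + selectedPairs + selectedPairs
      ≡⟨ sym (cong₂ (λ a b → a + b + ∑3 (λ x y z → triIn s x y z * selected s x z)) ∑-triIn-selected₁₂ ∑-triIn-selected₂₃ ⟨ trans ⟩ cong (selectedPairs + selectedPairs +_) ∑-triIn-selected₁₃) ⟩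
        ∑3 (λ x y z → triIn s x y z * selected s x y) + ∑3 (λ x y z → triIn s x y z * selected s y z) + ∑3 (λ x y z → triIn s x y z * selected s x z)
      ≡⟨ sym (trans (∑3-+ (λ x y z → triIn s x y z * selected s x y + triIn s x y z * selected s y z) (λ x y z → triIn s x y z * selected s x z))
                (cong (_+ ∑3 (λ x y z → triIn s x y z * selected s x z)) (∑3-+ (λ x y z → triIn s x y z * selected s x y) (λ x y z → triIn s x y z * selected s y z)))) ⟩
        ∑3 (λ x y z → triIn s x y z * selected s x y + triIn s x y z * selected s y z + triIn s x y z * selected s x z)
      ≡⟨ ∑3-cong (λ x y z → trans (sym (dist (triIn s x y z) (selected s x y) (selected s y z) (selected s x z))) (selected-edges-of-triangle x y z)) ⟩
        ∑3 (λ x y z → 2 * triIn s x y z)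
      ≡⟨ ∑-cong (λ x → trans (∑-cong λ y → ∑-*ˡ 2 (triIn s x y)) (∑-*ˡ 2 (λ y → ∑ (triIn s x y)))) ⟨ trans ⟩ ∑-*ˡ 2 (λ x → ∑ λ y → ∑ (triIn s x y)) ⟩
        2 * ordTriangles s ∎
      where
      open ≡-Reasoning
      e3 : ∀ p → 3 * p ≡ p + p + p
      e3 = solve-∀
      dist : ∀ t a b c → t * (a + b + c) ≡ t * a + t * b + t * c
      dist = solve-∀

    selected≤member : ∀ x y → selected s x y ≤ member s x
    selected≤member x y = go (Selected? s x y)
      where
      go : (p : Dec (Selected s x y)) → χ p ≤ member s x
      go (no _) = z≤n
      go (yes (sx , _)) = ≤-reflexive (sym (∈⇒member≡1 s x sx))

    selected-sym : ∀ x y → selected s x y ≡ selected s y x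
    selected-sym x y = χ-iff (Selected? s x y) (Selected? s y x) (Selected-sym s) (Selected-sym s)

    selected-triangle-free : ∀ x y z → selected s x y ≡ 1 → selected s x z + selected s y z ≤ member s z
    selected-triangle-free x y z e = go (χ>0 (Selected? s x y) (subst (0 <_) (sym e) (s≤s z≤n))) (Selected? s x z) (Selected? s y z)
      where
      go : Selected s x y → (p : Dec (Selected s x z)) → (q : Dec (Selected s y z)) → χ p + χ q ≤ member s z
      go fxy (yes fxz) (yes fyz) = ⊥-elim (notri fxy fxz fyz)
        where
        notri : Selected s x y → Selected s x z → Selected s y z → ⊥
        notri (sx , sy , axy , cxy , dxy) (_ , sz , axz , cxz , dxz) (_ , _ , ayz , cyz , dyz) = tri-max
          where
          tri-max : ⊥
          tri-max with <F-cmp x y | <F-cmp y z | <F-cmp x z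
          ... | tri≈ _ e _ | _ | _ = adj≢ axy e
          ... | _ | tri≈ _ e _ | _ = adj≢ ayz e
          ... | _ | _ | tri≈ _ e _ = adj≢ axz e
          ... | _ | tri< a _ _ | tri< b _ _ = dxy (z , sz , axz , ayz , b , a , cxz , cyz)
          ... | tri< a _ _ | tri> _ _ b | _ = dxz (y , sy , axy , Graph.sym G ayz , a , b , cxy , trans (commonNbrs-sym s z y) cyz)
          ... | tri> _ _ a | _ | tri> _ _ b = dyz (x , sx , Graph.sym G axy , Graph.sym G axz , a , b , trans (commonNbrs-sym s y x) cxy , trans (commonNbrs-sym s z x) cxz)
          ... | tri< a _ _ | tri< b _ _ | tri> _ _ c = <F-asym c (<F-trans a b)
          ... | tri> _ _ a | tri> _ _ b | tri< c _ _ = <F-asym c (<F-trans b a)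
      go fxy (yes (_ , sz , _)) (no _) = ≤-reflexive (trans (+-identityʳ 1) (sym (∈⇒member≡1 s z sz)))
      go fxy (no _) (yes (_ , sz , _)) = ≤-reflexive (sym (∈⇒member≡1 s z sz))
      go fxy (no _) (no _) = z≤n

    4*ordTriangles≤3*size² : 4 * ordTriangles s ≤ 3 * (size s * size s)
    4*ordTriangles≤3*size² = begin
        4 * ordTriangles s
      ≡⟨ e1 (ordTriangles s) ⟩
        2 * (2 * ordTriangles s)
      ≡⟨ cong (2 *_) (sym 3*selectedPairs≡2*ordTriangles) ⟩
        2 * (3 * selectedPairs)
      ≡⟨ e2 selectedPairs ⟩
        3 * (2 * selectedPairs)
      ≤⟨ *-monoʳ-≤ 3 (mantel (member s) (selected s) (member≤1 s) (λ x y → χ≤1 (Selected? s x y)) selected-sym selected≤member selected-triangle-free) ⟩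
        3 * (size s * size s) ∎
      where
      open ≤-Reasoning
      e1 : ∀ t → 4 * t ≡ 2 * (2 * t)
      e1 = solve-∀
      e2 : ∀ p → 2 * (3 * p) ≡ 3 * (2 * p)
      e2 = solve-∀

  TriangleBound : ℕ → Set
  TriangleBound k = ∀ s → size s ≡ k → k ≤ 11 → ordTriangles s ≤ 6 * maxTriangles k

  IsK4? : ∀ a b c d → Dec (IsK4 a b c d)
  IsK4? a b c d = map′ (λ { (p , q , r , u , v , w) → record { ab = p ; ac = q ; ad = r ; bc = u ; bd = v ; cd = w } })
    (λ K → IsK4.ab K , IsK4.ac K , IsK4.ad K , IsK4.bc K , IsK4.bd K , IsK4.cd K)
    (adj? G a b ×-dec adj? G a c ×-dec adj? G a d ×-dec adj? G b c ×-dec adj? G b d ×-dec adj? G c d)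

  HasK4 : VertexSet → Set
  HasK4 s = Σ[ a ∈ Fin n ] Σ[ b ∈ Fin n ] Σ[ c ∈ Fin n ] Σ[ d ∈ Fin n ] (s a ≡ true × s b ≡ true × s c ≡ true × s d ≡ true × IsK4 a b c d)

  HasK4? : ∀ s → Dec (HasK4 s)
  HasK4? s = any? λ a → any? λ b → any? λ c → any? λ d →
    (s a ≟B true) ×-dec (s b ≟B true) ×-dec (s c ≟B true) ×-dec (s d ≟B true) ×-dec IsK4? a b c d

  K4Free-case : ∀ s k → size s ≡ k → k ≤ 11 → K4Free s → ordTriangles s ≤ 6 * maxTriangles k
  K4Free-case s k sz le nk = subst (_≤ 6 * maxTriangles k) (sym (ordTriangles≡6*triangles s)) (*-monoʳ-≤ 6 (K4Free-maxTriangles k le (triangles s) h))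
    where
    open K4FreeBound s nk
    h : 24 * triangles s ≤ 3 * (k * k)
    h = subst₂ _≤_ (trans (cong (4 *_) (ordTriangles≡6*triangles s)) (e (triangles s))) (cong (λ m → 3 * (m * m)) sz) 4*ordTriangles≤3*size²
      where
      e : ∀ t → 4 * (6 * t) ≡ 24 * t
      e = solve-∀

  module WithK4 (s : VertexSet) (m : ℕ) (szs : size s ≡ m) (m11 : m ≤ 11) (rec : ∀ {k} → k < m → TriangleBound k)
             (a b c d : Fin n) (K : IsK4 a b c d) (sa : s a ≡ true) (sb : s b ≡ true) (sc : s c ≡ true) (sd : s d ≡ true) where

    module K = IsK4 K

    S1 S2 S3 S4 : VertexSet
    S1 = remove s a
    S2 = remove S1 b
    S3 = remove S2 c
    S4 = remove S3 d

    s1b : S1 b ≡ true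
    s1b = remove-∈ {s} sb (adj≢ (Graph.sym G K.ab))
    s2c : S2 c ≡ true
    s2c = remove-∈ {S1} (remove-∈ {s} sc (adj≢ (Graph.sym G K.ac))) (adj≢ (Graph.sym G K.bc))
    s3d : S3 d ≡ true
    s3d = remove-∈ {S2} (remove-∈ {S1} (remove-∈ {s} sd (adj≢ (Graph.sym G K.ad))) (adj≢ (Graph.sym G K.bd))) (adj≢ (Graph.sym G K.cd))

    out : Fin n → ℕ
    out = member S4

    split₀ : ∀ y → member s y ≡ out y + occ (a ∷ b ∷ c ∷ d ∷ []) y
    split₀ y = trans (member-split s a sa y) (trans (cong (_+ δ a y) (member-split S1 b s1b y))
             (trans (cong (λ e → e + δ b y + δ a y) (member-split S2 c s2c y))
             (trans (cong (λ e → e + δ c y + δ b y + δ a y) (member-split S3 d s3d y))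
             (e (out y) (δ a y) (δ b y) (δ c y) (δ d y)))))
      where
      e : ∀ o p q r t → o + t + r + q + p ≡ o + (p + (q + (r + (t + 0))))
      e = solve-∀

    out≤1 : ∀ y → out y ≤ 1
    out≤1 y = member≤1 S4 y

    X : ℕ
    X = ∑ out

    E deg : Fin n → ℕ
    E = outerTriangles out
    deg = outerDegree out

    outK : ∀ y → 0 < out y → y ≢ a × y ≢ b × y ≢ c × y ≢ d
    outK = out>0⇒∉K4 s out split₀

    outerDegrees≤X : deg a + deg b + deg c + deg d ≤ X
    outerDegrees≤X = outerDegrees≤ out out≤1 a b c d K outK

    outerTriangles-bound : ∀ v → E v + deg v ≤ deg v * deg v
    outerTriangles-bound v = outerTriangles+outerDegree≤outerDegree² out out≤1 v

    record Labelling : Set where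
      field
        i j k l : Fin n
        KL : IsK4 i j k l
        h : ∀ y → member s y ≡ out y + occ (i ∷ j ∷ k ∷ l ∷ []) y
        xs : deg i + deg j + deg k + deg l ≤ X

    labelling₀ : Labelling
    labelling₀ = record { i = a ; j = b ; k = c ; l = d ; KL = K ; h = split₀ ; xs = outerDegrees≤X }

    relabel₁₂ : Labelling → Labelling
    relabel₁₂ L = record { i = j ; j = i ; k = k ; l = l
      ; KL = IsK4-swap₁₂ KL
      ; h = λ y → trans (h y) (cong (out y +_) (e (δ i y) (δ j y) (occ (k ∷ l ∷ []) y)))
      ; xs = subst (_≤ X) (e2 (deg i) (deg j) (deg k) (deg l)) xs }
      where
      open Labelling L
      e : ∀ p q r → p + (q + r) ≡ q + (p + r)
      e = solve-∀
      e2 : ∀ p q r t → p + q + r + t ≡ q + p + r + t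
      e2 = solve-∀

    relabel₂₃ : Labelling → Labelling
    relabel₂₃ L = record { i = i ; j = k ; k = j ; l = l
      ; KL = IsK4-swap₂₃ KL
      ; h = λ y → trans (h y) (cong (out y +_) (e (δ i y) (δ j y) (δ k y) (occ (l ∷ []) y)))
      ; xs = subst (_≤ X) (e2 (deg i) (deg j) (deg k) (deg l)) xs }
      where
      open Labelling L
      e : ∀ o p q r → o + (p + (q + r)) ≡ o + (q + (p + r))
      e = solve-∀
      e2 : ∀ p q r t → p + q + r + t ≡ p + r + q + t
      e2 = solve-∀

    relabel₃₄ : Labelling → Labelling
    relabel₃₄ L = record { i = i ; j = j ; k = l ; l = k
      ; KL = IsK4-swap₃₄ KL
      ; h = λ y → trans (h y) (cong (out y +_) (e (δ i y) (δ j y) (δ k y) (δ l y)))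
      ; xs = subst (_≤ X) (e2 (deg i) (deg j) (deg k) (deg l)) xs }
      where
      open Labelling L
      e : ∀ o p q r → o + (p + (q + (r + 0))) ≡ o + (p + (r + (q + 0)))
      e = solve-∀
      e2 : ∀ p q r t → p + q + r + t ≡ p + q + t + r
      e2 = solve-∀

    data Sorted : Set where
      q4 : (L : Labelling) → E (Labelling.i L) ≡ 0 → E (Labelling.j L) ≡ 0 → E (Labelling.k L) ≡ 0 → E (Labelling.l L) ≡ 0 → Sorted
      q3 : (L : Labelling) → E (Labelling.i L) ≡ 0 → E (Labelling.j L) ≡ 0 → E (Labelling.k L) ≡ 0 → E (Labelling.l L) ≢ 0 → Sorted
      q2 : (L : Labelling) → E (Labelling.i L) ≡ 0 → E (Labelling.j L) ≡ 0 → E (Labelling.k L) ≢ 0 → E (Labelling.l L) ≢ 0 → Sorted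
      q1 : (L : Labelling) → E (Labelling.i L) ≡ 0 → E (Labelling.j L) ≢ 0 → E (Labelling.k L) ≢ 0 → E (Labelling.l L) ≢ 0 → Sorted
      q0 : (L : Labelling) → E (Labelling.i L) ≢ 0 → E (Labelling.j L) ≢ 0 → E (Labelling.k L) ≢ 0 → E (Labelling.l L) ≢ 0 → Sorted

    sorted : Sorted
    sorted = go (E a ≟ 0) (E b ≟ 0) (E c ≟ 0) (E d ≟ 0)
      where
      go : Dec (E a ≡ 0) → Dec (E b ≡ 0) → Dec (E c ≡ 0) → Dec (E d ≡ 0) → Sorted
      go (yes pa) (yes pb) (yes pc) (yes pd) = q4 labelling₀ pa pb pc pd
      go (yes pa) (yes pb) (yes pc) (no nd) = q3 labelling₀ pa pb pc nd
      go (yes pa) (yes pb) (no nc) (yes pd) = q3 (relabel₃₄ labelling₀) pa pb pd nc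
      go (yes pa) (yes pb) (no nc) (no nd) = q2 labelling₀ pa pb nc nd
      go (yes pa) (no nb) (yes pc) (yes pd) = q3 (relabel₃₄ (relabel₂₃ labelling₀)) pa pc pd nb
      go (yes pa) (no nb) (yes pc) (no nd) = q2 (relabel₂₃ labelling₀) pa pc nb nd
      go (yes pa) (no nb) (no nc) (yes pd) = q2 (relabel₂₃ (relabel₃₄ labelling₀)) pa pd nb nc
      go (yes pa) (no nb) (no nc) (no nd) = q1 labelling₀ pa nb nc nd
      go (no na) (yes pb) (yes pc) (yes pd) = q3 (relabel₃₄ (relabel₂₃ (relabel₁₂ labelling₀))) pb pc pd na
      go (no na) (yes pb) (yes pc) (no nd) = q2 (relabel₂₃ (relabel₁₂ labelling₀)) pb pc na nd
      go (no na) (yes pb) (no nc) (yes pd) = q2 (relabel₂₃ (relabel₃₄ (relabel₁₂ labelling₀))) pb pd na nc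
      go (no na) (yes pb) (no nc) (no nd) = q1 (relabel₁₂ labelling₀) pb na nc nd
      go (no na) (no nb) (yes pc) (yes pd) = q2 (relabel₂₃ (relabel₃₄ (relabel₁₂ (relabel₂₃ labelling₀)))) pc pd na nb
      go (no na) (no nb) (yes pc) (no nd) = q1 (relabel₁₂ (relabel₂₃ labelling₀)) pc na nb nd
      go (no na) (no nb) (no nc) (yes pd) = q1 (relabel₁₂ (relabel₂₃ (relabel₃₄ labelling₀))) pd na nb nc
      go (no na) (no nb) (no nc) (no nd) = q0 labelling₀ na nb nc nd

    size≡4+X : size s ≡ suc (suc (suc (suc X)))
    size≡4+X = trans (Peeling.size-i peeling₀) (cong suc (trans (Peeling.size-j peeling₀) (cong suc (trans (Peeling.size-k peeling₀) (cong suc (trans (Peeling.size-l peeling₀)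
             (cong suc (trans (∑-cong (Peeling.member-remainder peeling₀)) (∑-cong λ y → +-identityʳ (out y))))))))))
      where
      peeling₀ = peeling s out a b c d K split₀

    m≡4+X : m ≡ 4 + X
    m≡4+X = trans (sym szs) (trans size≡4+X refl)

    module Peel (L : Labelling) where
      open Labelling L
      decomposition : Peeling s out i j k l
      decomposition = peeling s out i j k l KL h
      open Peeling decomposition
      T1 T2 T3 T4 : VertexSet
      T1 = remove s i
      T2 = remove T1 j
      T3 = remove T2 k
      T4 = remove T3 l
      size₄ : size T4 ≡ X
      size₄ = trans (∑-cong member-remainder) (∑-cong λ y → +-identityʳ (out y))
      size₃ : size T3 ≡ 1 + X
      size₃ = trans size-l (cong suc size₄)
      size₂ : size T2 ≡ 2 + X
      size₂ = trans size-k (cong suc size₃)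
      size₁ : size T1 ≡ 3 + X
      size₁ = trans size-j (cong suc size₂)
      below-m : ∀ {q} → q + X < 4 + X → q + X < m
      below-m {q} p = subst (q + X <_) (sym m≡4+X) p
      at-most-11 : ∀ {q} → q + X ≤ 4 + X → q + X ≤ 11
      at-most-11 p = ≤-trans p (subst (_≤ 11) m≡4+X m11)
      ih₁ : ordTriangles T1 ≤ 6 * maxTriangles (3 + X)
      ih₁ = rec (below-m (+-monoˡ-< X (s≤s (s≤s (s≤s (s≤s z≤n)))))) T1 size₁ (at-most-11 (+-monoˡ-≤ X (s≤s (s≤s (s≤s z≤n)))))
      ih₂ : ordTriangles T2 ≤ 6 * maxTriangles (2 + X)
      ih₂ = rec (below-m (+-monoˡ-< X (s≤s (s≤s (s≤s z≤n))))) T2 size₂ (at-most-11 (+-monoˡ-≤ X (s≤s (s≤s z≤n))))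
      ih₃ : ordTriangles T3 ≤ 6 * maxTriangles (1 + X)
      ih₃ = rec (below-m (+-monoˡ-< X (s≤s (s≤s z≤n)))) T3 size₃ (at-most-11 (+-monoˡ-≤ X (s≤s z≤n)))
      ih₄ : ordTriangles T4 ≤ 6 * maxTriangles (0 + X)
      ih₄ = rec (below-m (+-monoˡ-< X (s≤s z≤n))) T4 size₄ (at-most-11 (+-monoˡ-≤ X z≤n))

      E1 E2 E3 E4 : ℕ
      E1 = 3 * (6 + E i)
      E2 = 3 * (2 + E j)
      E3 = 3 * E k
      E4 = 3 * E l

      peel₁ : ordTriangles s ≤ 6 * maxTriangles (3 + X) + E1
      peel₁ = subst (_≤ 6 * maxTriangles (3 + X) + E1) (sym ordTriangles-i) (+-monoˡ-≤ E1 ih₁)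

      peel₂ : ordTriangles s ≤ 6 * maxTriangles (2 + X) + (E1 + E2)
      peel₂ = subst (_≤ 6 * maxTriangles (2 + X) + (E1 + E2)) (sym (trans ordTriangles-i (trans (cong (_+ E1) ordTriangles-j) (ra (ordTriangles T2) E2 E1))))
               (+-monoˡ-≤ (E1 + E2) ih₂)
        where
        ra : ∀ t p q → t + p + q ≡ t + (q + p)
        ra = solve-∀

      peel₃ : ordTriangles s ≤ 6 * maxTriangles (1 + X) + (E1 + E2 + E3)
      peel₃ = subst (_≤ 6 * maxTriangles (1 + X) + (E1 + E2 + E3))
               (sym (trans ordTriangles-i (trans (cong (_+ E1) (trans ordTriangles-j (cong (_+ E2) ordTriangles-k))) (ra (ordTriangles T3) E3 E2 E1))))
               (+-monoˡ-≤ (E1 + E2 + E3) ih₃)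
        where
        ra : ∀ t p q r → t + p + q + r ≡ t + (r + q + p)
        ra = solve-∀

      peel₄ : ∀ B → ordTriangles T4 ≤ B → ordTriangles s ≤ B + (E1 + E2 + E3 + E4)
      peel₄ B hb = subst (_≤ B + (E1 + E2 + E3 + E4))
               (sym (trans ordTriangles-i (trans (cong (_+ E1) (trans ordTriangles-j (cong (_+ E2) (trans ordTriangles-k (cong (_+ E3) ordTriangles-l))))) (ra (ordTriangles T4) E4 E3 E2 E1))))
               (+-monoˡ-≤ (E1 + E2 + E3 + E4) hb)
        where
        ra : ∀ t p q r u → t + p + q + r + u ≡ t + (u + r + q + p)
        ra = solve-∀

      out-k : out k ≡ 0
      out-k = n≤0⇒n≡0 (≮⇒≥ λ k∈out → let (_ , _ , k≢k , _) = out>0⇒∉K4 s out h k k∈out in k≢k refl)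

      special : E k ≢ 0 → size T4 ≡ 4 → ordTriangles T4 ≤ 12
      special ≢0 size≡4 = *-cancelˡ-≤ 4 (≤-trans (K4FreeBound.4*ordTriangles≤3*size² T4 K4free) (≤-reflexive (cong (λ q → 3 * (q * q)) size≡4)))
        where
        ∈T4 : ∀ w → 0 < out w → T4 w ≡ true
        ∈T4 w p = member>0⇒∈ T4 w (subst (0 <_) (sym (member-remainder w)) (≤-trans p (m≤m+n (out w) 0)))
        k∉T4 : T4 k ≡ false
        k∉T4 with T4 k in eq
        ... | false = refl
        ... | true with () ← trans (sym (∈⇒member≡1 T4 k eq)) (trans (member-remainder k) (cong (_+ 0) out-k))
        K4free : K4Free T4
        K4free with outerTriangles>0⇒edge out k (n≢0⇒n>0 ≢0)
        ... | y , z , y∈ , z∈ , ky , kz , yz = K4Free-size-4 T4 size≡4 k∉T4 (∈T4 y y∈) (∈T4 z z∈) ky kz yz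

    +-mono-≤₄ : ∀ {a' b' c' d' a b c d} → a' ≤ a → b' ≤ b → c' ≤ c → d' ≤ d → a' + b' + c' + d' ≤ a + b + c + d
    +-mono-≤₄ p q r t = +-mono-≤ (+-mono-≤ (+-mono-≤ p q) r) t

    outerDegrees-bounded : (L : Labelling) → ∀ {p q r t} → p ≤ deg (Labelling.i L) → q ≤ deg (Labelling.j L) → r ≤ deg (Labelling.k L) → t ≤ deg (Labelling.l L) → p + q + r + t ≤ X
    outerDegrees-bounded L hp hq hr ht = ≤-trans (+-mono-≤₄ hp hq hr ht) (Labelling.xs L)

    E≢0⇒deg≥2 : ∀ v → E v ≢ 0 → 2 ≤ deg v
    E≢0⇒deg≥2 v ne = E+x≤x²∧E>0⇒x≥2 (outerTriangles-bound v) (n≢0⇒n>0 ne)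

    k<1+k+j : ∀ k j → k < suc k + j
    k<1+k+j k j = m≤m+n (suc k) j

    deg≱3⇒E≤2 : ∀ v → (3 ≤ deg v → ⊥) → E v ≤ 2
    deg≱3⇒E≤2 v f with deg v ≤? 2
    ... | yes le = E+x≤x²∧x≤2⇒E≤2 (outerTriangles-bound v) le
    ... | no nle = ⊥-elim (f (≰⇒> nle))

    3*-sum₃≤18 : ∀ {p q r} → p ≤ 2 → q ≤ 2 → r ≤ 2 → 3 * p + 3 * q + 3 * r ≤ 18
    3*-sum₃≤18 hp hq hr = +-mono-≤ (+-mono-≤ (*-monoʳ-≤ 3 hp) (*-monoʳ-≤ 3 hq)) (*-monoʳ-≤ 3 hr)

    3*-sum₂≤12 : ∀ {p q} → p ≤ 2 → q ≤ 2 → 3 * p + 3 * q ≤ 12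
    3*-sum₂≤12 hp hq = +-mono-≤ (*-monoʳ-≤ 3 hp) (*-monoʳ-≤ 3 hq)

    value-X≡7 : ∀ {x e} → x ≡ 7 → e ≡ 0 → 6 * maxTriangles (3 + x) + 3 * (6 + e) ≡ 90
    value-X≡7 refl refl = refl

    value-X≡6 : ∀ {x e1 e2} → x ≡ 6 → e1 ≡ 0 → e2 ≡ 0 → 6 * maxTriangles (2 + x) + (3 * (6 + e1) + 3 * (2 + e2)) ≡ 72
    value-X≡6 refl refl refl = refl

    value-X≡6-peel-all : ∀ {x e1 e2 e3 e4} → x ≡ 6 → e1 ≡ 0 → 6 * maxTriangles (0 + x) + (3 * (6 + e1) + 3 * (2 + e2) + 3 * e3 + 3 * e4) ≡ 54 + (3 * e2 + 3 * e3 + 3 * e4)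
    value-X≡6-peel-all {e2 = e2} {e3} {e4} refl refl = rearrange e2 e3 e4
      where
      rearrange : ∀ p q r → 30 + (18 + 3 * (2 + p) + 3 * q + 3 * r) ≡ 54 + (3 * p + 3 * q + 3 * r)
      rearrange = solve-∀

    value-X≡5 : ∀ {x e1 e2 e3} → x ≡ 5 → e1 ≡ 0 → e2 ≡ 0 → 6 * maxTriangles (1 + x) + (3 * (6 + e1) + 3 * (2 + e2) + 3 * e3) ≡ 54 + 3 * e3
    value-X≡5 refl refl refl = refl

    value-X≡4 : ∀ {x e1 e2 e3} → x ≡ 4 → e1 ≡ 0 → e2 ≡ 0 → e3 ≡ 0 → 6 * maxTriangles (1 + x) + (3 * (6 + e1) + 3 * (2 + e2) + 3 * e3) ≡ 48
    value-X≡4 refl refl refl refl = refl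

    value-X≡4-peel-all : ∀ {e1 e2 e3 e4} → e1 ≡ 0 → e2 ≡ 0 → 12 + (3 * (6 + e1) + 3 * (2 + e2) + 3 * e3 + 3 * e4) ≡ 36 + (3 * e3 + 3 * e4)
    value-X≡4-peel-all {e3 = e3} {e4} refl refl = rearrange e3 e4
      where
      rearrange : ∀ p q → 12 + (18 + 6 + 3 * p + 3 * q) ≡ 36 + (3 * p + 3 * q)
      rearrange = solve-∀

    ∑outerTriangles+X≤X² : E a + E b + E c + E d + X ≤ X * X
    ∑outerTriangles+X≤X² = E+s≤s²-mono {s = S} h outerDegrees≤X
      where
      S = deg a + deg b + deg c + deg d
      h : E a + E b + E c + E d + S ≤ S * S
      h = ≤-trans (≤-reflexive (re (E a) (E b) (E c) (E d) (deg a) (deg b) (deg c) (deg d)))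
            (≤-trans (+-mono-≤₄ (outerTriangles-bound a) (outerTriangles-bound b) (outerTriangles-bound c) (outerTriangles-bound d)) (sum-of-squares≤square-of-sum (deg a) (deg b) (deg c) (deg d)))
        where
        re : ∀ p q r t u v w z → p + q + r + t + (u + v + w + z) ≡ (p + u) + (q + v) + (r + w) + (t + z)
        re = solve-∀

    peel-all : ordTriangles s ≤ 6 * maxTriangles X + (24 + 3 * (E a + E b + E c + E d))
    peel-all = subst (ordTriangles s ≤_) (cong (6 * maxTriangles X +_) (re (E a) (E b) (E c) (E d))) (Peel.peel₄ labelling₀ _ (Peel.ih₄ labelling₀))
      where
      re : ∀ p q r t → 3 * (6 + p) + 3 * (2 + q) + 3 * r + 3 * t ≡ 24 + 3 * (p + q + r + t)
      re = solve-∀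

    ΣE : ℕ
    ΣE = E a + E b + E c + E d

    small-outside : ∀ Xv → X ≡ Xv → (∀ e → e + Xv ≤ Xv * Xv → 6 * maxTriangles Xv + (24 + 3 * e) ≤ 6 * maxTriangles (4 + Xv)) → ordTriangles s ≤ 6 * maxTriangles (4 + Xv)
    small-outside Xv eX f = ≤-trans (subst (λ x → ordTriangles s ≤ 6 * maxTriangles x + (24 + 3 * ΣE)) eX peel-all) (f ΣE (subst (λ x → ΣE + x ≤ x * x) eX ∑outerTriangles+X≤X²))

    24+3*-mono : ∀ {e} k c → e + c ≤ k + c → 24 + 3 * e ≤ 24 + 3 * k
    24+3*-mono {e} k c h = +-monoʳ-≤ 24 (*-monoʳ-≤ 3 (+-cancelʳ-≤ c e k h))

    bound-X≡4 : X ≡ 4 → ordTriangles s ≤ 6 * maxTriangles (4 + 4)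
    bound-X≡4 eX with sorted
    ... | q4 L p q r _ = ≤-trans (Peel.peel₃ L) (≤-reflexive (value-X≡4 {e1 = E (Labelling.i L)} {E (Labelling.j L)} {E (Labelling.k L)} eX p q r))
    ... | q3 L p q r _ = ≤-trans (Peel.peel₃ L) (≤-reflexive (value-X≡4 {e1 = E (Labelling.i L)} {E (Labelling.j L)} {E (Labelling.k L)} eX p q r))
    ... | q2 L p q nk nl = ≤-trans (Peel.peel₄ L 12 (Peel.special L nk (trans (Peel.size₄ L) eX)))
            (≤-trans (≤-reflexive (value-X≡4-peel-all {E (Labelling.i L)} {E (Labelling.j L)} {E (Labelling.k L)} {E (Labelling.l L)} p q)) (+-monoʳ-≤ 36 (3*-sum₂≤12 (deg≱3⇒E≤2 (Labelling.k L) fk) (deg≱3⇒E≤2 (Labelling.l L) fl))))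
      where
      fk : 3 ≤ deg (Labelling.k L) → ⊥
      fk h3 = <⇒≱ (k<1+k+j 4 0) (subst (5 ≤_) eX (outerDegrees-bounded L z≤n z≤n h3 (E≢0⇒deg≥2 (Labelling.l L) nl)))
      fl : 3 ≤ deg (Labelling.l L) → ⊥
      fl h3 = <⇒≱ (k<1+k+j 4 0) (subst (5 ≤_) eX (outerDegrees-bounded L z≤n z≤n (E≢0⇒deg≥2 (Labelling.k L) nk) h3))
    ... | q1 L p nj nk nl = ⊥-elim (<⇒≱ (k<1+k+j 4 1) (subst (6 ≤_) eX (outerDegrees-bounded L z≤n (E≢0⇒deg≥2 _ nj) (E≢0⇒deg≥2 _ nk) (E≢0⇒deg≥2 _ nl))))
    ... | q0 L ni nj nk nl = ⊥-elim (<⇒≱ (k<1+k+j 4 3) (subst (8 ≤_) eX (outerDegrees-bounded L (E≢0⇒deg≥2 _ ni) (E≢0⇒deg≥2 _ nj) (E≢0⇒deg≥2 _ nk) (E≢0⇒deg≥2 _ nl))))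

    bound-X≡5 : X ≡ 5 → ordTriangles s ≤ 6 * maxTriangles (4 + 5)
    bound-X≡5 eX with sorted
    ... | q4 L p q r _ = ≤-trans (Peel.peel₃ L) (≤-trans (≤-reflexive (value-X≡5 {e1 = E (Labelling.i L)} {E (Labelling.j L)} {E (Labelling.k L)} eX p q)) (subst (λ e → 54 + 3 * e ≤ 60) (sym r) (m≤m+n 54 6)))
    ... | q3 L p q r _ = ≤-trans (Peel.peel₃ L) (≤-trans (≤-reflexive (value-X≡5 {e1 = E (Labelling.i L)} {E (Labelling.j L)} {E (Labelling.k L)} eX p q)) (subst (λ e → 54 + 3 * e ≤ 60) (sym r) (m≤m+n 54 6)))
    ... | q2 L p q nk nl with deg (Labelling.k L) ≤? 2
    ...   | yes xk = ≤-trans (Peel.peel₃ L) (≤-trans (≤-reflexive (value-X≡5 {e1 = E (Labelling.i L)} {E (Labelling.j L)} {E (Labelling.k L)} eX p q)) (+-monoʳ-≤ 54 (*-monoʳ-≤ 3 (E+x≤x²∧x≤2⇒E≤2 (outerTriangles-bound (Labelling.k L)) xk))))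
    ...   | no xk = ≤-trans (Peel.peel₃ (relabel₃₄ L)) (≤-trans (≤-reflexive (value-X≡5 {e1 = E (Labelling.i L)} {E (Labelling.j L)} {E (Labelling.l L)} eX p q)) (+-monoʳ-≤ 54 (*-monoʳ-≤ 3 (deg≱3⇒E≤2 (Labelling.l L) fl))))
      where
      fl : 3 ≤ deg (Labelling.l L) → ⊥
      fl h3 = <⇒≱ (k<1+k+j 5 0) (subst (6 ≤_) eX (outerDegrees-bounded L z≤n z≤n (≰⇒> xk) h3))
    bound-X≡5 eX | q1 L p nj nk nl = ⊥-elim (<⇒≱ (k<1+k+j 5 0) (subst (6 ≤_) eX (outerDegrees-bounded L z≤n (E≢0⇒deg≥2 _ nj) (E≢0⇒deg≥2 _ nk) (E≢0⇒deg≥2 _ nl))))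
    bound-X≡5 eX | q0 L ni nj nk nl = ⊥-elim (<⇒≱ (k<1+k+j 5 2) (subst (8 ≤_) eX (outerDegrees-bounded L (E≢0⇒deg≥2 _ ni) (E≢0⇒deg≥2 _ nj) (E≢0⇒deg≥2 _ nk) (E≢0⇒deg≥2 _ nl))))

    bound-X≡6 : X ≡ 6 → ordTriangles s ≤ 6 * maxTriangles (4 + 6)
    bound-X≡6 eX with sorted
    ... | q4 L p q _ _ = ≤-trans (Peel.peel₂ L) (≤-reflexive (value-X≡6 {e1 = E (Labelling.i L)} {E (Labelling.j L)} eX p q))
    ... | q3 L p q _ _ = ≤-trans (Peel.peel₂ L) (≤-reflexive (value-X≡6 {e1 = E (Labelling.i L)} {E (Labelling.j L)} eX p q))
    ... | q2 L p q _ _ = ≤-trans (Peel.peel₂ L) (≤-reflexive (value-X≡6 {e1 = E (Labelling.i L)} {E (Labelling.j L)} eX p q))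
    ... | q1 L p nj nk nl = ≤-trans (Peel.peel₄ L _ (Peel.ih₄ L)) (≤-trans (≤-reflexive (value-X≡6-peel-all {e1 = E (Labelling.i L)} {E (Labelling.j L)} {E (Labelling.k L)} {E (Labelling.l L)} eX p))
            (+-monoʳ-≤ 54 (3*-sum₃≤18 (deg≱3⇒E≤2 (Labelling.j L) fj) (deg≱3⇒E≤2 (Labelling.k L) fk) (deg≱3⇒E≤2 (Labelling.l L) fl))))
      where
      fj : 3 ≤ deg (Labelling.j L) → ⊥
      fj h3 = <⇒≱ (n<1+n 6) (subst (7 ≤_) eX (outerDegrees-bounded L z≤n h3 (E≢0⇒deg≥2 _ nk) (E≢0⇒deg≥2 _ nl)))
      fk : 3 ≤ deg (Labelling.k L) → ⊥
      fk h3 = <⇒≱ (n<1+n 6) (subst (7 ≤_) eX (outerDegrees-bounded L z≤n (E≢0⇒deg≥2 _ nj) h3 (E≢0⇒deg≥2 _ nl)))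
      fl : 3 ≤ deg (Labelling.l L) → ⊥
      fl h3 = <⇒≱ (n<1+n 6) (subst (7 ≤_) eX (outerDegrees-bounded L z≤n (E≢0⇒deg≥2 _ nj) (E≢0⇒deg≥2 _ nk) h3))
    ... | q0 L ni nj nk nl = ⊥-elim (<⇒≱ (k<1+k+j 6 1) (subst (8 ≤_) eX (outerDegrees-bounded L (E≢0⇒deg≥2 _ ni) (E≢0⇒deg≥2 _ nj) (E≢0⇒deg≥2 _ nk) (E≢0⇒deg≥2 _ nl))))

    bound-X≡7 : X ≡ 7 → ordTriangles s ≤ 6 * maxTriangles (4 + 7)
    bound-X≡7 eX with sorted
    ... | q4 L p _ _ _ = ≤-trans (Peel.peel₁ L) (≤-reflexive (value-X≡7 {e = E (Labelling.i L)} eX p))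
    ... | q3 L p _ _ _ = ≤-trans (Peel.peel₁ L) (≤-reflexive (value-X≡7 {e = E (Labelling.i L)} eX p))
    ... | q2 L p _ _ _ = ≤-trans (Peel.peel₁ L) (≤-reflexive (value-X≡7 {e = E (Labelling.i L)} eX p))
    ... | q1 L p _ _ _ = ≤-trans (Peel.peel₁ L) (≤-reflexive (value-X≡7 {e = E (Labelling.i L)} eX p))
    ... | q0 L ni nj nk nl = ⊥-elim (<⇒≱ (k<1+k+j 7 0) (subst (8 ≤_) eX (outerDegrees-bounded L (E≢0⇒deg≥2 _ ni) (E≢0⇒deg≥2 _ nj) (E≢0⇒deg≥2 _ nk) (E≢0⇒deg≥2 _ nl))))

    -- For X ≤ 3 peel all four vertices and use ∑ outerTriangles ≤ X² − X. For 4 ≤ X ≤ 7 a vertex with an outer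
    -- triangle has outer degree ≥ 2 and the outer degrees sum to at most X, so peeling the vertices without outer
    -- triangles first and stopping early leaves a set covered by the induction hypothesis.
    bound-by-outside-size : ∀ Xv → X ≡ Xv → ordTriangles s ≤ 6 * maxTriangles (4 + Xv)
    bound-by-outside-size 0 eX = small-outside 0 eX λ e h → 24+3*-mono 0 0 h
    bound-by-outside-size 1 eX = small-outside 1 eX λ e h → 24+3*-mono 0 1 h
    bound-by-outside-size 2 eX = small-outside 2 eX λ e h → 24+3*-mono 2 2 h
    bound-by-outside-size 3 eX = small-outside 3 eX λ e h → +-monoʳ-≤ 6 (24+3*-mono 6 3 h)
    bound-by-outside-size 4 eX = bound-X≡4 eX
    bound-by-outside-size 5 eX = bound-X≡5 eX
    bound-by-outside-size 6 eX = bound-X≡6 eX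
    bound-by-outside-size 7 eX = bound-X≡7 eX
    bound-by-outside-size (suc (suc (suc (suc (suc (suc (suc (suc Xv)))))))) eX =
      ⊥-elim (<⇒≱ (k<1+k+j 11 0) (≤-trans (m≤m+n 12 Xv) (≤-trans (≤-reflexive (sym (trans m≡4+X (cong (4 +_) eX)))) m11)))

    K4-case : ordTriangles s ≤ 6 * maxTriangles m
    K4-case = subst (λ q → ordTriangles s ≤ 6 * maxTriangles q) (sym m≡4+X) (bound-by-outside-size X refl)

  triangleBound : ∀ m → TriangleBound m
  triangleBound = <-rec TriangleBound body
    where
    body : ∀ m → (∀ {k} → k < m → TriangleBound k) → TriangleBound m
    body m rec s sz le with HasK4? s
    ... | yes (a , b , c , d , sa , sb , sc , sd , K) = WithK4.K4-case s m sz le rec a b c d K sa sb sc sd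
    ... | no nk = K4Free-case s m sz le (λ {a} {b} {c} {d} sa sb sc sd K → nk (a , b , c , d , sa , sb , sc , sd , K))

  triangleCount≤maxTriangles : n ≤ 11 → triangleCount G ≤ maxTriangles n
  triangleCount≤maxTriangles le = *-cancelˡ-≤ 6 (subst (_≤ 6 * maxTriangles n) (trans (ordTriangles≡6*triangles everything) (cong (6 *_) (sym triangleCount≡triangles))) (triangleBound n everything szall le))
    where
    szall : size everything ≡ n
    szall = trans (∑-const {n} 1) (*-identityʳ n)

Gem : ∀ {n} → Graph n → Set
Gem {n} G = Σ[ c ∈ Fin n ] Σ[ p ∈ Fin n ] Σ[ q ∈ Fin n ] Σ[ r ∈ Fin n ] Σ[ s ∈ Fin n ]
  (Adj G c p × Adj G c q × Adj G c r × Adj G c s × Adj G p q × Adj G q r × Adj G r s × p ≢ r × p ≢ s × q ≢ s)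

Gem? : ∀ {n} (G : Graph n) → Dec (Gem G)
Gem? G = any? λ c → any? λ p → any? λ q → any? λ r → any? λ s →
  adj? G c p ×-dec adj? G c q ×-dec adj? G c r ×-dec adj? G c s ×-dec adj? G p q ×-dec adj? G q r ×-dec adj? G r s
  ×-dec ¬? (p ≟F r) ×-dec ¬? (p ≟F s) ×-dec ¬? (q ≟F s)

¬Gem⇒NoGem : ∀ {n} (G : Graph n) → ¬ Gem G → NoGem G
¬Gem⇒NoGem G ¬gem cp cq cr cs pq qr rs p≢r p≢s q≢s = ¬gem (_ , _ , _ , _ , _ , cp , cq , cr , cs , pq , qr , rs , p≢r , p≢s , q≢s)

Gem⇒ContainsP4Hat : ∀ {n} (G : Graph n) → Gem G → ContainsP4Hat G
Gem⇒ContainsP4Hat G (c , p , q , r , s , cp , cq , cr , cs , pq , qr , rs , p≢r , p≢s , q≢s) = f , f-injective , f-edge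
  where
  open Triangles G using (adj≢)
  f : Fin 5 → Fin _
  f 0F = p
  f 1F = q
  f 2F = r
  f 3F = s
  f 4F = c
  f-edge : ∀ {a b} → P4HatEdge a b → Adj G (f a) (f b)
  f-edge e01 = pq
  f-edge e12 = qr
  f-edge e23 = rs
  f-edge e40 = cp
  f-edge e41 = cq
  f-edge e42 = cr
  f-edge e43 = cs
  f-injective : ∀ {a b} → f a ≡ f b → a ≡ b
  f-injective {0F} {0F} _ = refl
  f-injective {0F} {1F} e = ⊥-elim (adj≢ pq e)
  f-injective {0F} {2F} e = ⊥-elim (p≢r e)
  f-injective {0F} {3F} e = ⊥-elim (p≢s e)
  f-injective {0F} {4F} e = ⊥-elim (adj≢ cp (sym e))
  f-injective {1F} {0F} e = ⊥-elim (adj≢ pq (sym e))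
  f-injective {1F} {1F} _ = refl
  f-injective {1F} {2F} e = ⊥-elim (adj≢ qr e)
  f-injective {1F} {3F} e = ⊥-elim (q≢s e)
  f-injective {1F} {4F} e = ⊥-elim (adj≢ cq (sym e))
  f-injective {2F} {0F} e = ⊥-elim (p≢r (sym e))
  f-injective {2F} {1F} e = ⊥-elim (adj≢ qr (sym e))
  f-injective {2F} {2F} _ = refl
  f-injective {2F} {3F} e = ⊥-elim (adj≢ rs e)
  f-injective {2F} {4F} e = ⊥-elim (adj≢ cr (sym e))
  f-injective {3F} {0F} e = ⊥-elim (p≢s (sym e))
  f-injective {3F} {1F} e = ⊥-elim (q≢s (sym e))
  f-injective {3F} {2F} e = ⊥-elim (adj≢ rs (sym e))
  f-injective {3F} {3F} _ = refl
  f-injective {3F} {4F} e = ⊥-elim (adj≢ cs (sym e))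
  f-injective {4F} {0F} e = ⊥-elim (adj≢ cp e)
  f-injective {4F} {1F} e = ⊥-elim (adj≢ cq e)
  f-injective {4F} {2F} e = ⊥-elim (adj≢ cr e)
  f-injective {4F} {3F} e = ⊥-elim (adj≢ cs e)
  f-injective {4F} {4F} _ = refl

maxTriangles<triangleCount⇒ContainsP4Hat : ∀ {n} (G : Graph n) → n ≤ 11 → maxTriangles n < triangleCount G → ContainsP4Hat G
maxTriangles<triangleCount⇒ContainsP4Hat G n≤11 many with Gem? G
... | yes gem = Gem⇒ContainsP4Hat G gem
... | no ¬gem = ⊥-elim (<⇒≱ many (GemFree.triangleCount≤maxTriangles G (¬Gem⇒NoGem G ¬gem) n≤11))

theorem2 : (n t : ℕ) →
    ((n ≡ 9 × t ≡ 11) ⊎ (n ≡ 10 × t ≡ 13) ⊎ (n ≡ 11 × t ≡ 16)) →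
    (G : Graph n) → EveryEdgeInTriangle G → triangleCount G ≡ t →
    ContainsP4Hat G
theorem2 n t (inj₁ (refl , refl)) G _ count≡11 =
  maxTriangles<triangleCount⇒ContainsP4Hat G (m≤m+n 9 2) (subst (10 <_) (sym count≡11) (n<1+n 10))
theorem2 n t (inj₂ (inj₁ (refl , refl))) G _ count≡13 =
  maxTriangles<triangleCount⇒ContainsP4Hat G (m≤m+n 10 1) (subst (12 <_) (sym count≡13) (n<1+n 12))
theorem2 n t (inj₂ (inj₂ (refl , refl))) G _ count≡16 =
  maxTriangles<triangleCount⇒ContainsP4Hat G ≤-refl (subst (15 <_) (sym count≡16) (n<1+n 15))
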